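{- There is an absolute constant $c>0$ such that the following holds for all $n$ and $\varepsilon$ with $c>\varepsilon\ge 2^{ -n^{0.49}}$. Let $a:=\log_2(1/\varepsilon)$, $q:=n^{0.001\log_2(1/\varepsilon)}$ and let $Q=\{x^1,\dots,x^q\}\subseteq\{0,1\}^n$ be any set of $q$ points. Let $\mathsf{Bad}$ be the event (over the random draw of $\mathbf A,\mathbf T$ described below) that there exist $x,y\in Q$ and $\ell\in[L]$ with $S_{\mathbf T}(x_{\mathbf C})=S_{\mathbf T}(y_{\mathbf C})=\{\ell\}$ and $x_{\mathbf A}=\overline{y_{\mathbf A}}$ (the bitwise complement of $y_{\mathbf A}$). Then $\Pr[\mathsf{Bad}]=o_n(1)$.
   Context: Parameters: $a:=\log_2(1/\varepsilon)$, $c':=n-a$, $L:=0.1\cdot 2^{\sqrt{c'}}$ (assumed integers). $\mathbf A$ is a uniformly random $a$-element subset of $[n]$, $\mathbf C=[n]\setminus\mathbf A$. $\mathbf T=(\mathbf T_1,\dots,\mathbf T_L)$ where each $\mathbf T_\ell$ is obtained by drawing $\sqrt{c'}$ elements of $\mathbf C$ independently and uniformly with replacement. For $w\in\{0,1\}^{\mathbf C}$, $S_{\mathbf T}(w)=\{\ell\in[L]: w_j=1\ \forall j\in\mathbf T_\ell\}$. For $x\in\{0,1\}^n$ and $S\subseteq[n]$, $x_S$ is the restriction of $x$ to $S$. -}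

module Defs where

open import Data.Bool using (Bool; true; false; _∧_; _∨_; not; _xor_; if_then_else_)
open import Data.Nat using (ℕ; zero; suc)
open import Data.Fin using (Fin; _≟_)
open import Data.Vec using (Vec; []; _∷_; lookup; toList)
open import Data.List using (List; [_]; map; concatMap; allFin; filterᵇ; length)
import Data.List as L
open import Data.Bool.ListAction using (all; any)
open import Data.Product using (_×_; _,_)
open import Relation.Nullary using (does)

vecs : {X : Set} → List X → (k : ℕ) → List (Vec X k)
vecs xs zero = [ [] ]
vecs xs (suc k) = concatMap (λ v → map (_∷ v) xs) (vecs xs k)

weight : {n : ℕ} → Vec Bool n → ℕ
weight [] = 0
weight (true ∷ v) = suc (weight v)
weight (false ∷ v) = weight v

_==_ : ℕ → ℕ → Bool
zero == zero = true
suc m == suc n = m == n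
_ == _ = false

-- a subset of [n] is its indicator vector; A ↦ all a-element subsets of [n]
subsetsOfSize : (n a : ℕ) → List (Vec Bool n)
subsetsOfSize n a = filterᵇ (λ A → weight A == a) (vecs (true L.∷ false L.∷ L.[]) n)

Tuples : (n s L : ℕ) → Set
Tuples n s L = Vec (Vec (Fin n) s) L

-- every entry of T lies in C = [n] \ A
inC : {n s L : ℕ} → Vec Bool n → Tuples n s L → Bool
inC A T = all (λ Tℓ → all (λ j → not (lookup A j)) (toList Tℓ)) (toList T)

-- sample space: pairs (A,T) with |A| = a and all entries of T in C;
-- uniform distribution on it = A uniform, then each T_ℓ,j uniform in C independently
sampleSpace : (n a s L : ℕ) → List (Vec Bool n × Tuples n s L)
sampleSpace n a s L =
  concatMap (λ A → map (A ,_) (filterᵇ (inC A) (vecs (vecs (allFin n) s) L)))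
            (subsetsOfSize n a)

-- ℓ ∈ S_T(x_C)  (T_ℓ ⊆ C, so reading x at T_ℓ reads x_C)
inS : {n s L : ℕ} → Tuples n s L → Vec Bool n → Fin L → Bool
inS T x ℓ = all (λ j → lookup x j) (toList (lookup T ℓ))

iff : Bool → Bool → Bool
iff b c = not (b xor c)

SIsSingleton : {n s L : ℕ} → Tuples n s L → Vec Bool n → Fin L → Bool
SIsSingleton {L = L} T x ℓ = all (λ ℓ' → iff (inS T x ℓ') (does (ℓ' ≟ ℓ))) (allFin L)

complementOn : {n : ℕ} → Vec Bool n → Vec Bool n → Vec Bool n → Bool
complementOn {n} A x y =
  all (λ i → not (lookup A i) ∨ (lookup x i xor lookup y i)) (allFin n)

Bad : {n s L : ℕ} → List (Vec Bool n) → Vec Bool n × Tuples n s L → Bool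
Bad {L = L} Q (A , T) =
  any (λ x → any (λ y → any (λ ℓ →
    SIsSingleton T x ℓ ∧ SIsSingleton T y ℓ ∧ complementOn A x y) (allFin L)) Q) Q

totalCount : (n a s L : ℕ) → ℕ
totalCount n a s L = length (sampleSpace n a s L)

badCount : (n a s L : ℕ) → List (Vec Bool n) → ℕ
badCount n a s L Q = length (filterᵇ (Bad Q) (sampleSpace n a s L))

-- Fix x, y ∈ Q. If Bad happens through (x, y, ℓ), then A lies in the set D where x and y differ,
-- T_ℓ ⊆ C ∩ x ∩ y, and every other T_i ⊆ C meets C ∖ x. Counting such (A, T) exactly gives
--   Pr ≤ (|D| choose a) / (n choose a) · (1 - e / |C|)^s,
-- where e ≥ |D| / 2 - a bounds |C ∩ (x ∖ y)| in the better orientation; the sum over ℓ is absorbed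
-- by Bernoulli's inequality (L + 1) p (1 - p)^L ≤ 1. Let r = ⌊n^(1/1000)⌋. If |D| is small, the first
-- factor is at most (|D| / n)^a ≤ 1 / (k q²). Otherwise e ≥ r^998 / 4k while s ≥ r^499, so the second
-- factor is at most 2^(-r^496) ≤ 1 / (k q²). A union bound over the q² pairs gives k · |Bad| ≤ |Ω|.
{-# OPTIONS --safe #-}
module Submission where

open import Defs
open import Data.Bool using (Bool; true; false; _∧_; _∨_; not; _xor_; if_then_else_)
open import Data.Bool.ListAction using (all; any)
open import Data.Bool.Properties using (∧-identityʳ; ∧-zeroʳ; ∧-comm; ∨-zeroʳ)
open import Data.Fin using (Fin; zero; suc; _≟_)
open import Data.List using (List; []; _∷_; _++_; map; concatMap; filterᵇ; length; tabulate; allFin)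
open import Data.List.Properties using (length-++; length-map; length-tabulate; map-cong)
open import Data.List.Relation.Unary.Unique.Propositional using (Unique)
open import Data.Nat using (ℕ; zero; suc; _+_; _*_; _∸_; _^_; _/_; _⊔_; _≤_; _<_; z≤n; s≤s; s≤s⁻¹; _≤?_; NonZero; >-nonZero)
open import Data.Nat.Combinatorics using (_C_; nC1≡n; nCk+nC[k+1]≡[n+1]C[k+1])
open import Data.Nat.ListAction using (sum)
open import Data.Nat.Properties hiding (_≟_)
open import Algebra.Properties.CommutativeSemigroup +-commutativeSemigroup using () renaming (interchange to +-interchange)
open import Algebra.Properties.CommutativeSemigroup *-commutativeSemigroup using () renaming (x∙yz≈y∙xz to x*[y*z]≡y*[x*z])
open import Data.Nat.Solver using (module +-*-Solver)
open import Data.Product using (∃-syntax; _×_; _,_; proj₁; proj₂)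
open import Data.Vec using (Vec; []; _∷_; lookup; toList)
open import Relation.Binary.PropositionalEquality
open import Relation.Nullary using (Dec; yes; no; does; contradiction)
open +-*-Solver using (solve; _:+_; _:*_; _:=_; con)

private variable
  A B I : Set
  k n a s L : ℕ

-- Counting with boolean predicates

toℕ : Bool → ℕ
toℕ true = 1
toℕ false = 0

∧≡true⁻ : ∀ b {c} → b ∧ c ≡ true → b ≡ true × c ≡ true
∧≡true⁻ true {true} _ = refl , refl

iff-trueʳ : ∀ b → iff b true ≡ b
iff-trueʳ true = refl
iff-trueʳ false = refl

iff-falseʳ : ∀ b → iff b false ≡ true → b ≡ false
iff-falseʳ false _ = refl

==⇒≡ : ∀ m n → (m == n) ≡ true → m ≡ n
==⇒≡ zero zero _ = refl
==⇒≡ (suc m) (suc n) eq = cong suc (==⇒≡ m n eq)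

all-∧ : (p q : A → Bool) (xs : List A) → all (λ z → p z ∧ q z) xs ≡ all p xs ∧ all q xs
all-∧ p q [] = refl
all-∧ p q (x ∷ xs) with p x | q x
... | true | true = all-∧ p q xs
... | true | false = sym (∧-zeroʳ (all p xs))
... | false | _ = refl

∧-any : (b : Bool) (g : A → Bool) (xs : List A) → b ∧ any g xs ≡ any (λ x → b ∧ g x) xs
∧-any true g xs = refl
∧-any false g [] = refl
∧-any false g (x ∷ xs) = ∧-any false g xs

any-cong : {f g : A → Bool} → (∀ z → f z ≡ g z) → (xs : List A) → any f xs ≡ any g xs
any-cong f≗g [] = refl
any-cong f≗g (x ∷ xs) = cong₂ _∨_ (f≗g x) (any-cong f≗g xs)

countᵇ : (A → Bool) → List A → ℕ
countᵇ p xs = length (filterᵇ p xs)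

countᵇ-∷ : (p : A → Bool) (x : A) (xs : List A) → countᵇ p (x ∷ xs) ≡ toℕ (p x) + countᵇ p xs
countᵇ-∷ p x xs with p x
... | true = refl
... | false = refl

countᵇ-++ : (p : A → Bool) (xs ys : List A) → countᵇ p (xs ++ ys) ≡ countᵇ p xs + countᵇ p ys
countᵇ-++ p [] ys = refl
countᵇ-++ p (x ∷ xs) ys with p x
... | true = cong suc (countᵇ-++ p xs ys)
... | false = countᵇ-++ p xs ys

countᵇ-concatMap : (p : B → Bool) (f : A → List B) (xs : List A) →
  countᵇ p (concatMap f xs) ≡ sum (map (λ x → countᵇ p (f x)) xs)
countᵇ-concatMap p f [] = refl
countᵇ-concatMap p f (x ∷ xs) =
  trans (countᵇ-++ p (f x) (concatMap f xs)) (cong (countᵇ p (f x) +_) (countᵇ-concatMap p f xs))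

countᵇ-map : (p : B → Bool) (g : A → B) (xs : List A) → countᵇ p (map g xs) ≡ countᵇ (λ x → p (g x)) xs
countᵇ-map p g [] = refl
countᵇ-map p g (x ∷ xs) with p (g x)
... | true = cong suc (countᵇ-map p g xs)
... | false = countᵇ-map p g xs

countᵇ-filterᵇ : (p q : A → Bool) (xs : List A) → countᵇ p (filterᵇ q xs) ≡ countᵇ (λ x → q x ∧ p x) xs
countᵇ-filterᵇ p q [] = refl
countᵇ-filterᵇ p q (x ∷ xs) with q x
... | false = countᵇ-filterᵇ p q xs
... | true with p x
...   | true = cong suc (countᵇ-filterᵇ p q xs)
...   | false = countᵇ-filterᵇ p q xs

countᵇ-cong : {p q : A → Bool} → (∀ x → p x ≡ q x) → (xs : List A) → countᵇ p xs ≡ countᵇ q xs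
countᵇ-cong p≗q [] = refl
countᵇ-cong {p = p} {q} p≗q (x ∷ xs) with p x | q x | p≗q x
... | true | true | refl = cong suc (countᵇ-cong p≗q xs)
... | false | false | refl = countᵇ-cong p≗q xs

countᵇ-mono : {p q : A → Bool} → (∀ x → p x ≡ true → q x ≡ true) → (xs : List A) → countᵇ p xs ≤ countᵇ q xs
countᵇ-mono p⇒q [] = z≤n
countᵇ-mono {p = p} {q} p⇒q (x ∷ xs) with p x in px | q x in qx
... | true | true = s≤s (countᵇ-mono p⇒q xs)
... | true | false with () ← trans (sym (p⇒q x px)) qx
... | false | true = m≤n⇒m≤1+n (countᵇ-mono p⇒q xs)
... | false | false = countᵇ-mono p⇒q xs

countᵇ-none : {p : A → Bool} → (∀ x → p x ≡ false) → (xs : List A) → countᵇ p xs ≡ 0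
countᵇ-none none [] = refl
countᵇ-none {p = p} none (x ∷ xs) rewrite none x = countᵇ-none none xs

countᵇ-∨ : (p q : A → Bool) (xs : List A) → countᵇ (λ x → p x ∨ q x) xs ≤ countᵇ p xs + countᵇ q xs
countᵇ-∨ p q [] = z≤n
countᵇ-∨ p q (x ∷ xs) with p x | q x
... | true | true = s≤s (≤-trans (countᵇ-∨ p q xs) (+-monoʳ-≤ (countᵇ p xs) (n≤1+n _)))
... | true | false = s≤s (countᵇ-∨ p q xs)
... | false | true = ≤-trans (s≤s (countᵇ-∨ p q xs)) (≤-reflexive (sym (+-suc (countᵇ p xs) (countᵇ q xs))))
... | false | false = countᵇ-∨ p q xs

countᵇ-any : (f : I → A → Bool) (is : List I) (xs : List A) →
  countᵇ (λ x → any (λ i → f i x) is) xs ≤ sum (map (λ i → countᵇ (f i) xs) is)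
countᵇ-any f [] xs = ≤-reflexive (countᵇ-none (λ _ → refl) xs)
countᵇ-any f (i ∷ is) xs = ≤-trans (countᵇ-∨ (f i) (λ x → any (λ i → f i x) is) xs)
                                  (+-monoʳ-≤ (countᵇ (f i) xs) (countᵇ-any f is xs))

countᵇ-∧-not : {p q : A → Bool} → (∀ x → q x ≡ true → p x ≡ true) → (xs : List A) →
  countᵇ (λ x → p x ∧ not (q x)) xs + countᵇ q xs ≡ countᵇ p xs
countᵇ-∧-not q⇒p [] = refl
countᵇ-∧-not {p = p} {q} q⇒p (x ∷ xs) with q x in qx | p x in px
... | true | true = trans (+-suc _ _) (cong suc (countᵇ-∧-not q⇒p xs))
... | true | false with () ← trans (sym (q⇒p x qx)) px
... | false | true = cong suc (countᵇ-∧-not q⇒p xs)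
... | false | false = countᵇ-∧-not q⇒p xs

countᵇ-∧ʳ : (p : A → Bool) (b : Bool) (xs : List A) → countᵇ (λ x → p x ∧ b) xs ≡ countᵇ p xs * toℕ b
countᵇ-∧ʳ p true xs = trans (countᵇ-cong (λ x → ∧-identityʳ (p x)) xs) (sym (*-identityʳ _))
countᵇ-∧ʳ p false xs = trans (countᵇ-none (λ x → ∧-zeroʳ (p x)) xs) (sym (*-zeroʳ (countᵇ p xs)))

length-concatMap : (f : A → List B) (xs : List A) → length (concatMap f xs) ≡ sum (map (λ x → length (f x)) xs)
length-concatMap f [] = refl
length-concatMap f (x ∷ xs) = trans (length-++ (f x)) (cong (length (f x) +_) (length-concatMap f xs))

sum-toℕ : (p : A → Bool) (xs : List A) → sum (map (λ x → toℕ (p x)) xs) ≡ countᵇ p xs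
sum-toℕ p [] = refl
sum-toℕ p (x ∷ xs) = trans (cong (toℕ (p x) +_) (sum-toℕ p xs)) (sym (countᵇ-∷ p x xs))

sum-mono-≤ : {f g : I → ℕ} → (∀ i → f i ≤ g i) → (is : List I) → sum (map f is) ≤ sum (map g is)
sum-mono-≤ f≤g [] = z≤n
sum-mono-≤ f≤g (i ∷ is) = +-mono-≤ (f≤g i) (sum-mono-≤ f≤g is)

sum-const : (c : ℕ) (is : List I) → sum (map (λ _ → c) is) ≡ length is * c
sum-const c [] = refl
sum-const c (i ∷ is) = cong (c +_) (sum-const c is)

sum-*ˡ : (c : ℕ) (f : I → ℕ) (is : List I) → sum (map (λ i → c * f i) is) ≡ c * sum (map f is)
sum-*ˡ c f [] = sym (*-zeroʳ c)
sum-*ˡ c f (i ∷ is) = trans (cong (c * f i +_) (sum-*ˡ c f is)) (sym (*-distribˡ-+ c (f i) _))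

sum-*ʳ : (c : ℕ) (f : I → ℕ) (is : List I) → sum (map (λ i → f i * c) is) ≡ sum (map f is) * c
sum-*ʳ c f [] = refl
sum-*ʳ c f (i ∷ is) = trans (cong (f i * c +_) (sum-*ʳ c f is)) (sym (*-distribʳ-+ c (f i) _))

sum-map-+ : (f g : A → ℕ) (xs : List A) → sum (map (λ x → f x + g x) xs) ≡ sum (map f xs) + sum (map g xs)
sum-map-+ f g [] = refl
sum-map-+ f g (x ∷ xs) = trans (cong (f x + g x +_) (sum-map-+ f g xs)) (+-interchange (f x) (g x) _ _)

sum-filterᵇ-≤ : (f : I → ℕ) (q p : I → Bool) (c : ℕ) → (∀ i → q i ≡ true → f i ≤ toℕ (p i) * c) →
  (is : List I) → sum (map f (filterᵇ q is)) ≤ countᵇ p (filterᵇ q is) * c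
sum-filterᵇ-≤ f q p c f≤ [] = z≤n
sum-filterᵇ-≤ f q p c f≤ (i ∷ is) with q i in qi
... | false = sum-filterᵇ-≤ f q p c f≤ is
... | true = ≤-trans (+-mono-≤ (f≤ i qi) (sum-filterᵇ-≤ f q p c f≤ is))
                     (≤-reflexive (trans (sym (*-distribʳ-+ c (toℕ (p i)) _))
                                         (cong (_* c) (sym (countᵇ-∷ p i (filterᵇ q is))))))

sum-filterᵇ-const : (f : I → ℕ) (q : I → Bool) (c : ℕ) → (∀ i → q i ≡ true → f i ≡ c) →
  (is : List I) → sum (map f (filterᵇ q is)) ≡ countᵇ q is * c
sum-filterᵇ-const f q c f≡ [] = refl
sum-filterᵇ-const f q c f≡ (i ∷ is) with q i in qi
... | false = sum-filterᵇ-const f q c f≡ is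
... | true = cong₂ _+_ (f≡ i qi) (sum-filterᵇ-const f q c f≡ is)

double-sum-≤ : (f : A → A → ℕ) (c : ℕ) → (∀ x y → f x y ≤ c) → (xs : List A) →
  sum (map (λ x → sum (map (λ y → f x y) xs)) xs) ≤ length xs * (length xs * c)
double-sum-≤ f c f≤c xs = begin
  sum (map (λ x → sum (map (λ y → f x y) xs)) xs) ≤⟨ sum-mono-≤ (λ x → sum-mono-≤ (λ y → f≤c x y) xs) xs ⟩
  sum (map (λ _ → sum (map (λ _ → c) xs)) xs)     ≡⟨ cong sum (map-cong (λ _ → sum-const c xs) xs) ⟩
  sum (map (λ _ → length xs * c) xs)              ≡⟨ sum-const (length xs * c) xs ⟩
  length xs * (length xs * c)                     ∎
  where open ≤-Reasoning

-- Counting over Fin n and over tuples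

countFin : (Fin n → Bool) → ℕ
countFin {zero} p = 0
countFin {suc n} p = toℕ (p zero) + countFin (λ i → p (suc i))

allFinᵇ : (Fin n → Bool) → Bool
allFinᵇ {zero} p = true
allFinᵇ {suc n} p = p zero ∧ allFinᵇ (λ i → p (suc i))

countᵇ-tabulate : (p : A → Bool) (f : Fin n → A) → countᵇ p (tabulate f) ≡ countFin (λ i → p (f i))
countᵇ-tabulate {n = zero} p f = refl
countᵇ-tabulate {n = suc n} p f =
  trans (countᵇ-∷ p (f zero) _) (cong (toℕ (p (f zero)) +_) (countᵇ-tabulate p (λ i → f (suc i))))

countᵇ-allFin : (p : Fin n → Bool) → countᵇ p (allFin n) ≡ countFin p
countᵇ-allFin p = countᵇ-tabulate p (λ i → i)

all-tabulate : (p : A → Bool) (f : Fin n → A) → all p (tabulate f) ≡ allFinᵇ (λ i → p (f i))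
all-tabulate {n = zero} p f = refl
all-tabulate {n = suc n} p f = cong (p (f zero) ∧_) (all-tabulate p (λ i → f (suc i)))

all-allFin : (p : Fin n → Bool) → all p (allFin n) ≡ allFinᵇ p
all-allFin p = all-tabulate p (λ i → i)

allFinᵇ-intro : (p : Fin n → Bool) → (∀ i → p i ≡ true) → allFinᵇ p ≡ true
allFinᵇ-intro {zero} p _ = refl
allFinᵇ-intro {suc n} p holds rewrite holds zero = allFinᵇ-intro (λ i → p (suc i)) (λ i → holds (suc i))

allFinᵇ-elim : (p : Fin n → Bool) → allFinᵇ p ≡ true → ∀ i → p i ≡ true
allFinᵇ-elim p holds zero with p zero
... | true = refl
allFinᵇ-elim p holds (suc i) with p zero
... | true = allFinᵇ-elim (λ i → p (suc i)) holds i

countFin-+ : (f g h : Fin n → Bool) → (∀ i → toℕ (f i) ≡ toℕ (g i) + toℕ (h i)) →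
  countFin f ≡ countFin g + countFin h
countFin-+ {zero} f g h split = refl
countFin-+ {suc n} f g h split =
  trans (cong₂ _+_ (split zero) (countFin-+ _ _ _ (λ i → split (suc i))))
        (+-interchange (toℕ (g zero)) (toℕ (h zero)) _ _)

countFin-≤-+ : (f g h : Fin n → Bool) → (∀ i → toℕ (f i) ≤ toℕ (g i) + toℕ (h i)) →
  countFin f ≤ countFin g + countFin h
countFin-≤-+ {zero} f g h cover = z≤n
countFin-≤-+ {suc n} f g h cover =
  ≤-trans (+-mono-≤ (cover zero) (countFin-≤-+ _ _ _ (λ i → cover (suc i))))
          (≤-reflexive (+-interchange (toℕ (g zero)) (toℕ (h zero)) _ _))

countFin-≤ : (p : Fin n → Bool) → countFin p ≤ n
countFin-≤ {zero} p = z≤n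
countFin-≤ {suc n} p with p zero
... | true = s≤s (countFin-≤ (λ i → p (suc i)))
... | false = m≤n⇒m≤1+n (countFin-≤ (λ i → p (suc i)))

countFin-true : (n : ℕ) → countFin {n} (λ _ → true) ≡ n
countFin-true zero = refl
countFin-true (suc n) = cong suc (countFin-true n)

countFin-lookup : (A : Vec Bool n) → countFin (lookup A) ≡ weight A
countFin-lookup [] = refl
countFin-lookup (true ∷ A) = cong suc (countFin-lookup A)
countFin-lookup (false ∷ A) = countFin-lookup A

countFin-not-lookup : (A : Vec Bool n) → countFin (λ j → not (lookup A j)) ≡ n ∸ weight A
countFin-not-lookup [] = refl
countFin-not-lookup (true ∷ A) = countFin-not-lookup A
countFin-not-lookup (false ∷ A) = trans (cong suc (countFin-not-lookup A)) (sym (+-∸-assoc 1 (weight≤ A)))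
  where
  weight≤ : ∀ {m} (v : Vec Bool m) → weight v ≤ m
  weight≤ v = subst (_≤ _) (countFin-lookup v) (countFin-≤ (lookup v))

allAt : (Fin k → A → Bool) → Vec A k → Bool
allAt f [] = true
allAt f (x ∷ v) = f zero x ∧ allAt (λ i → f (suc i)) v

∏ : (Fin k → ℕ) → ℕ
∏ {zero} f = 1
∏ {suc k} f = f zero * ∏ (λ i → f (suc i))

allAt-intro : (f : Fin k → A → Bool) (v : Vec A k) → (∀ i → f i (lookup v i) ≡ true) → allAt f v ≡ true
allAt-intro f [] _ = refl
allAt-intro f (x ∷ v) holds rewrite holds zero = allAt-intro (λ i → f (suc i)) v (λ i → holds (suc i))

allAt-elim : (f : Fin k → A → Bool) (v : Vec A k) → allAt f v ≡ true → ∀ i → f i (lookup v i) ≡ true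
allAt-elim f (x ∷ v) holds zero with f zero x
... | true = refl
allAt-elim f (x ∷ v) holds (suc i) with f zero x
... | true = allAt-elim (λ i → f (suc i)) v holds i

all-toList : (p : A → Bool) (v : Vec A k) → all p (toList v) ≡ allAt (λ _ → p) v
all-toList p [] = refl
all-toList p (x ∷ v) = cong (p x ∧_) (all-toList p v)

∏-cong : {f g : Fin k → ℕ} → (∀ i → f i ≡ g i) → ∏ f ≡ ∏ g
∏-cong {zero} f≗g = refl
∏-cong {suc k} f≗g = cong₂ _*_ (f≗g zero) (∏-cong (λ i → f≗g (suc i)))

∏-const : (k c : ℕ) → ∏ {k} (λ _ → c) ≡ c ^ k
∏-const zero c = refl
∏-const (suc k) c = cong (c *_) (∏-const k c)

∏-single : (ℓ : Fin (suc k)) (g h : ℕ) → ∏ (λ i → if does (i ≟ ℓ) then g else h) ≡ g * h ^ k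
∏-single {k} zero g h = cong (g *_) (∏-const k h)
∏-single {suc k} (suc ℓ) g h = begin
  h * ∏ (λ i → if does (i ≟ ℓ) then g else h) ≡⟨ cong (h *_) (∏-single ℓ g h) ⟩
  h * (g * h ^ k)                              ≡⟨ x*[y*z]≡y*[x*z] h g (h ^ k) ⟩
  g * (h * h ^ k)                              ∎
  where open ≡-Reasoning

countᵇ-allAt : {A : Set} (f : Fin k → A → Bool) (xs : List A) →
  countᵇ (allAt f) (vecs xs k) ≡ ∏ (λ i → countᵇ (f i) xs)
countᵇ-allAt {k = zero} f xs = refl
countᵇ-allAt {k = suc k} {A = A} f xs = begin
  countᵇ (allAt f) (concatMap (λ v → map (_∷ v) xs) (vecs xs k))
    ≡⟨ countᵇ-concatMap (allAt f) _ (vecs xs k) ⟩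
  sum (map (λ v → countᵇ (allAt f) (map (_∷ v) xs)) (vecs xs k))
    ≡⟨ cong sum (map-cong (λ v → trans (countᵇ-map (allAt f) (_∷ v) xs) (countᵇ-∧ʳ (f zero) (rest v) xs)) (vecs xs k)) ⟩
  sum (map (λ v → countᵇ (f zero) xs * toℕ (rest v)) (vecs xs k))
    ≡⟨ cong sum (map-cong (λ v → *-comm (countᵇ (f zero) xs) _) (vecs xs k)) ⟩
  sum (map (λ v → toℕ (rest v) * countᵇ (f zero) xs) (vecs xs k))
    ≡⟨ sum-*ʳ (countᵇ (f zero) xs) (λ v → toℕ (rest v)) (vecs xs k) ⟩
  sum (map (λ v → toℕ (rest v)) (vecs xs k)) * countᵇ (f zero) xs
    ≡⟨ cong (_* countᵇ (f zero) xs) (trans (sum-toℕ rest (vecs xs k)) (countᵇ-allAt (λ i → f (suc i)) xs)) ⟩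
  ∏ (λ i → countᵇ (f (suc i)) xs) * countᵇ (f zero) xs
    ≡⟨ *-comm _ (countᵇ (f zero) xs) ⟩
  ∏ (λ i → countᵇ (f i) xs) ∎
  where
  open ≡-Reasoning
  rest : Vec A k → Bool
  rest = allAt (λ i → f (suc i))

countᵇ-all-vecs : (s : ℕ) (p : A → Bool) (xs : List A) →
  countᵇ (λ v → all p (toList v)) (vecs xs s) ≡ countᵇ p xs ^ s
countᵇ-all-vecs s p xs = begin
  countᵇ (λ v → all p (toList v)) (vecs xs s) ≡⟨ countᵇ-cong (all-toList p) (vecs xs s) ⟩
  countᵇ (allAt (λ _ → p)) (vecs xs s)         ≡⟨ countᵇ-allAt {k = s} (λ _ → p) xs ⟩
  ∏ {s} (λ _ → countᵇ p xs)                    ≡⟨ ∏-const s _ ⟩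
  countᵇ p xs ^ s                              ∎
  where open ≡-Reasoning

-- Subsets of a given size

bits : List Bool
bits = true ∷ false ∷ []

_⊆ᵇ_ : Vec Bool n → (Fin n → Bool) → Bool
S ⊆ᵇ D = allFinᵇ (λ i → not (lookup S i) ∨ D i)

countᵇ-vecs-suc : (P : Vec Bool (suc n) → Bool) → countᵇ P (vecs bits (suc n)) ≡
  countᵇ (λ v → P (true ∷ v)) (vecs bits n) + countᵇ (λ v → P (false ∷ v)) (vecs bits n)
countᵇ-vecs-suc {n} P = begin
  countᵇ P (vecs bits (suc n))
    ≡⟨ countᵇ-concatMap P (λ v → map (_∷ v) bits) (vecs bits n) ⟩
  sum (map (λ v → countᵇ P (map (_∷ v) bits)) (vecs bits n))
    ≡⟨ cong sum (map-cong countᵇ-pair (vecs bits n)) ⟩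
  sum (map (λ v → toℕ (P (true ∷ v)) + toℕ (P (false ∷ v))) (vecs bits n))
    ≡⟨ sum-map-+ _ _ (vecs bits n) ⟩
  sum (map (λ v → toℕ (P (true ∷ v))) (vecs bits n)) + sum (map (λ v → toℕ (P (false ∷ v))) (vecs bits n))
    ≡⟨ cong₂ _+_ (sum-toℕ _ (vecs bits n)) (sum-toℕ _ (vecs bits n)) ⟩
  countᵇ (λ v → P (true ∷ v)) (vecs bits n) + countᵇ (λ v → P (false ∷ v)) (vecs bits n) ∎
  where
  open ≡-Reasoning
  countᵇ-pair : (v : Vec Bool n) → countᵇ P (map (_∷ v) bits) ≡ toℕ (P (true ∷ v)) + toℕ (P (false ∷ v))
  countᵇ-pair v = trans (countᵇ-∷ P (true ∷ v) _)
    (cong (toℕ (P (true ∷ v)) +_) (trans (countᵇ-∷ P (false ∷ v) []) (+-identityʳ _)))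

countᵇ-subsets-⊆ : (D : Fin n → Bool) (a : ℕ) →
  countᵇ (λ S → (weight S == a) ∧ S ⊆ᵇ D) (vecs bits n) ≡ countFin D C a
countᵇ-subsets-⊆ {zero} D zero = refl
countᵇ-subsets-⊆ {zero} D (suc a) = refl
countᵇ-subsets-⊆ {suc n} D zero = begin
  countᵇ (λ S → (weight S == 0) ∧ S ⊆ᵇ D) (vecs bits (suc n))
    ≡⟨ countᵇ-vecs-suc (λ S → (weight S == 0) ∧ S ⊆ᵇ D) ⟩
  countᵇ (λ S → (weight (true ∷ S) == 0) ∧ (true ∷ S) ⊆ᵇ D) (vecs bits n)
    + countᵇ (λ S → (weight S == 0) ∧ S ⊆ᵇ D′) (vecs bits n)
    ≡⟨ cong (_+ countᵇ (λ S → (weight S == 0) ∧ S ⊆ᵇ D′) (vecs bits n)) (countᵇ-none (λ _ → refl) (vecs bits n)) ⟩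
  countᵇ (λ S → (weight S == 0) ∧ S ⊆ᵇ D′) (vecs bits n)
    ≡⟨ countᵇ-subsets-⊆ D′ zero ⟩
  1 ∎
  where
  open ≡-Reasoning
  D′ : Fin n → Bool
  D′ i = D (suc i)
countᵇ-subsets-⊆ {suc n} D (suc a) = begin
  countᵇ (λ S → (weight S == suc a) ∧ S ⊆ᵇ D) (vecs bits (suc n))
    ≡⟨ countᵇ-vecs-suc (λ S → (weight S == suc a) ∧ S ⊆ᵇ D) ⟩
  countᵇ (λ S → (weight S == a) ∧ (D zero ∧ S ⊆ᵇ D′)) (vecs bits n)
    + countᵇ (λ S → (weight S == suc a) ∧ S ⊆ᵇ D′) (vecs bits n)
    ≡⟨ cong₂ _+_ (countᵇ-head (D zero) refl) (countᵇ-subsets-⊆ D′ (suc a)) ⟩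
  toℕ (D zero) * (countFin D′ C a) + countFin D′ C suc a
    ≡⟨ pascal (D zero) ⟩
  countFin D C suc a ∎
  where
  open ≡-Reasoning
  D′ : Fin n → Bool
  D′ i = D (suc i)
  countᵇ-head : (b : Bool) → D zero ≡ b →
    countᵇ (λ S → (weight S == a) ∧ (D zero ∧ S ⊆ᵇ D′)) (vecs bits n) ≡ toℕ b * (countFin D′ C a)
  countᵇ-head true d₀ = trans (countᵇ-cong (λ S → cong (λ b → (weight S == a) ∧ (b ∧ S ⊆ᵇ D′)) d₀) (vecs bits n))
                              (trans (countᵇ-subsets-⊆ D′ a) (sym (+-identityʳ _)))
  countᵇ-head false d₀ = countᵇ-none (λ S → trans (cong (λ b → (weight S == a) ∧ (b ∧ S ⊆ᵇ D′)) d₀) (∧-zeroʳ _)) (vecs bits n)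
  pascal : (b : Bool) → toℕ b * (countFin D′ C a) + countFin D′ C suc a ≡ (toℕ b + countFin D′) C suc a
  pascal true = trans (cong (_+ countFin D′ C suc a) (+-identityʳ _)) (nCk+nC[k+1]≡[n+1]C[k+1] (countFin D′) a)
  pascal false = refl

-- Elementary inequalities

^-distribʳ-* : ∀ m n p → (m * n) ^ p ≡ m ^ p * n ^ p
^-distribʳ-* m n zero = refl
^-distribʳ-* m n (suc p) = trans (cong (m * n *_) (^-distribʳ-* m n p))
  (solve 4 (λ m n a b → m :* n :* (a :* b) := m :* a :* (n :* b)) refl m n (m ^ p) (n ^ p))

^-cancelˡ-≤ : ∀ p .{{_ : NonZero p}} m n → m ^ p ≤ n ^ p → m ≤ n
^-cancelˡ-≤ p m n mᵖ≤nᵖ with m ≤? n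
... | yes m≤n = m≤n
... | no m≰n = contradiction mᵖ≤nᵖ (<⇒≱ (^-monoˡ-< p (≰⇒> m≰n)))

^-cancelˡ-< : ∀ p m n → m ^ p < n ^ p → m < n
^-cancelˡ-< p m n mᵖ<nᵖ with n ≤? m
... | yes n≤m = contradiction (^-monoˡ-≤ p n≤m) (<⇒≱ mᵖ<nᵖ)
... | no n≰m = ≰⇒> n≰m

1≤m^n : ∀ m n → 1 ≤ m → 1 ≤ m ^ n
1≤m^n m zero _ = s≤s z≤n
1≤m^n m (suc n) 1≤m = *-mono-≤ 1≤m (1≤m^n m n 1≤m)

m≤m^n : ∀ m n → 1 ≤ m → 1 ≤ n → m ≤ m ^ n
m≤m^n m (suc n) 1≤m _ = ≤-trans (≤-reflexive (sym (*-identityʳ m))) (*-monoʳ-≤ m (1≤m^n m n 1≤m))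

m^n≤m^[n+o] : ∀ m n o → 1 ≤ m → m ^ n ≤ m ^ (n + o)
m^n≤m^[n+o] m n o 1≤m = ≤-trans (≤-reflexive (sym (*-identityʳ _)))
  (≤-trans (*-monoʳ-≤ (m ^ n) (1≤m^n m o 1≤m)) (≤-reflexive (sym (^-distribˡ-+-* m n o))))

n<2^n : ∀ n → n < 2 ^ n
n<2^n zero = s≤s z≤n
n<2^n (suc n) = +-mono-≤ (≤-trans (s≤s z≤n) (n<2^n n)) (≤-trans (n<2^n n) (≤-reflexive (sym (+-identityʳ _))))

2*n≤2^n : ∀ n → 1 ≤ n → 2 * n ≤ 2 ^ n
2*n≤2^n (suc n) _ = *-monoʳ-≤ 2 (n<2^n n)

-- Stated with r + 1 rather than suc r: the type checker would unfold suc r ^ 1000.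
integer-root : ∀ p .{{_ : NonZero p}} n → ∃[ r ] (r ^ p ≤ n × n < (r + 1) ^ p)
integer-root p@(suc _) zero = 0 , z≤n , 1≤m^n 1 p ≤-refl
integer-root p (suc n) with integer-root p n
... | r , rᵖ≤n , n<[r+1]ᵖ with (r + 1) ^ p ≤? suc n
...   | yes [r+1]ᵖ≤1+n = r + 1 , [r+1]ᵖ≤1+n , ≤-trans (s≤s n<[r+1]ᵖ) (^-monoˡ-< p (m<m+n (r + 1) ≤-refl))
...   | no [r+1]ᵖ≰1+n = r , m≤n⇒m≤1+n rᵖ≤n , ≰⇒> [r+1]ᵖ≰1+n

bernoulli : ∀ L w u → w ^ suc L + suc L * u * w ^ L ≤ (w + u) ^ suc L
bernoulli zero w u = ≤-reflexive (solve 2 (λ w u → w :* con 1 :+ con 1 :* u :* con 1 := (w :+ u) :* con 1) refl w u)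
bernoulli (suc L) w u = begin
  w * (w * w ^ L) + suc (suc L) * u * (w * w ^ L)
    ≤⟨ m≤m+n _ (suc L * u * u * w ^ L) ⟩
  w * (w * w ^ L) + suc (suc L) * u * (w * w ^ L) + suc L * u * u * w ^ L
    ≡⟨ solve 4 (λ w u l wl → w :* (w :* wl) :+ (con 2 :+ l) :* u :* (w :* wl) :+ (con 1 :+ l) :* u :* u :* wl
                             := (w :+ u) :* (w :* wl :+ (con 1 :+ l) :* u :* wl)) refl w u L (w ^ L) ⟩
  (w + u) * (w * w ^ L + suc L * u * w ^ L)
    ≤⟨ *-monoʳ-≤ (w + u) (bernoulli L w u) ⟩
  (w + u) * (w + u) ^ suc L ∎
  where open ≤-Reasoning

-- Pr[exactly one of L + 1 independent trials with success probability u / N succeeds] ≤ 1.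
one-success-≤ : ∀ L N u → u ≤ N → suc L * u * (N ∸ u) ^ L ≤ N ^ suc L
one-success-≤ L N u u≤N = begin
  suc L * u * (N ∸ u) ^ L                           ≤⟨ m≤n+m _ _ ⟩
  (N ∸ u) ^ suc L + suc L * u * (N ∸ u) ^ L         ≤⟨ bernoulli L (N ∸ u) u ⟩
  (N ∸ u + u) ^ suc L                               ≡⟨ cong (_^ suc L) (m∸n+n≡m u≤N) ⟩
  N ^ suc L                                         ∎
  where open ≤-Reasoning

halving : ∀ j N e → N ≤ suc j * e → 2 * (N ∸ e) ^ suc j ≤ N ^ suc j
halving j N e N≤[1+j]e with e ≤? N
... | no e≰N = ≤-trans (≤-reflexive (trans (cong (λ w → 2 * (w * (N ∸ e) ^ j)) (m≤n⇒m∸n≡0 (<⇒≤ (≰⇒> e≰N)))) (*-zeroʳ 2))) z≤n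
... | yes e≤N = begin
  2 * (w * w ^ j)             ≡⟨ solve 2 (λ w v → con 2 :* (w :* v) := w :* v :+ w :* v) refl w (w ^ j) ⟩
  w * w ^ j + w * w ^ j       ≤⟨ +-monoʳ-≤ (w * w ^ j) (*-monoˡ-≤ (w ^ j) (≤-trans (m∸n≤m N e) N≤[1+j]e)) ⟩
  w ^ suc j + suc j * e * w ^ j ≤⟨ bernoulli j w e ⟩
  (w + e) ^ suc j             ≡⟨ cong (_^ suc j) (m∸n+n≡m e≤N) ⟩
  N ^ suc j                   ∎
  where
  open ≤-Reasoning
  w : ℕ
  w = N ∸ e

halving-iterate : ∀ b j N e → N ≤ suc j * e → 2 ^ b * (N ∸ e) ^ (b * suc j) ≤ N ^ (b * suc j)
halving-iterate zero j N e _ = ≤-refl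
halving-iterate (suc b) j N e N≤[1+j]e = begin
  2 * 2 ^ b * (N ∸ e) ^ (suc j + b * suc j)
    ≡⟨ cong (2 * 2 ^ b *_) (^-distribˡ-+-* (N ∸ e) (suc j) (b * suc j)) ⟩
  2 * 2 ^ b * ((N ∸ e) ^ suc j * (N ∸ e) ^ (b * suc j))
    ≡⟨ solve 4 (λ t u x y → t :* u :* (x :* y) := (t :* x) :* (u :* y)) refl 2 (2 ^ b) ((N ∸ e) ^ suc j) ((N ∸ e) ^ (b * suc j)) ⟩
  (2 * (N ∸ e) ^ suc j) * (2 ^ b * (N ∸ e) ^ (b * suc j))
    ≤⟨ *-mono-≤ (halving j N e N≤[1+j]e) (halving-iterate b j N e N≤[1+j]e) ⟩
  N ^ suc j * N ^ (b * suc j)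
    ≡⟨ sym (^-distribˡ-+-* N (suc j) (b * suc j)) ⟩
  N ^ (suc j + b * suc j) ∎
  where open ≤-Reasoning

decay : ∀ b j s N e → N ≤ suc j * e → b * suc j ≤ s → 2 ^ b * (N ∸ e) ^ s ≤ N ^ s
decay b j s N e N≤[1+j]e bj≤s = begin
  2 ^ b * (N ∸ e) ^ s                           ≡⟨ cong (λ t → 2 ^ b * (N ∸ e) ^ t) (sym (m+[n∸m]≡n bj≤s)) ⟩
  2 ^ b * (N ∸ e) ^ (m + (s ∸ m))               ≡⟨ cong (2 ^ b *_) (^-distribˡ-+-* (N ∸ e) m (s ∸ m)) ⟩
  2 ^ b * ((N ∸ e) ^ m * (N ∸ e) ^ (s ∸ m))     ≡⟨ sym (*-assoc (2 ^ b) _ _) ⟩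
  2 ^ b * (N ∸ e) ^ m * (N ∸ e) ^ (s ∸ m)       ≤⟨ *-mono-≤ (halving-iterate b j N e N≤[1+j]e) (^-monoˡ-≤ (s ∸ m) (m∸n≤m N e)) ⟩
  N ^ m * N ^ (s ∸ m)                           ≡⟨ sym (^-distribˡ-+-* N m (s ∸ m)) ⟩
  N ^ (m + (s ∸ m))                             ≡⟨ cong (N ^_) (m+[n∸m]≡n bj≤s) ⟩
  N ^ s                                         ∎
  where
  open ≤-Reasoning
  m : ℕ
  m = b * suc j

P*N≤[N∸e]*X : ∀ P E X N e → P + E ≡ X → X ≤ N → e ≤ E → P * N ≤ (N ∸ e) * X
P*N≤[N∸e]*X P E X N e P+E≡X X≤N e≤E = +-cancelʳ-≤ (e * X) (P * N) ((N ∸ e) * X) (begin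
  P * N + e * X       ≤⟨ +-monoʳ-≤ (P * N) (*-monoʳ-≤ e X≤N) ⟩
  P * N + e * N       ≡⟨ *-distribʳ-+ N P e ⟨
  (P + e) * N         ≤⟨ *-monoˡ-≤ N (≤-trans (+-monoʳ-≤ P e≤E) (≤-reflexive P+E≡X)) ⟩
  X * N               ≡⟨ *-comm X N ⟩
  N * X               ≡⟨ cong (_* X) (m∸n+n≡m e≤N) ⟨
  (N ∸ e + e) * X     ≡⟨ *-distribʳ-+ X (N ∸ e) e ⟩
  (N ∸ e) * X + e * X ∎)
  where
  open ≤-Reasoning
  e≤N : e ≤ N
  e≤N = ≤-trans e≤E (≤-trans (m≤n+m E P) (≤-trans (≤-reflexive P+E≡X) X≤N))

-- The ratio of P^s (N^s - X^s)^L, summed over the L + 1 choices of the singleton, to (N^s)^(L+1)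
-- is at most (P/X)^s by one-success-≤, and P/X ≤ 1 - e/N.
singleton-bound : ∀ s L P E X N e → P + E ≡ X → X ≤ N → e ≤ E →
  suc L * (P ^ s * (N ^ s ∸ X ^ s) ^ L) * N ^ s ≤ (N ∸ e) ^ s * (N ^ s) ^ suc L
singleton-bound s L P E X N e P+E≡X X≤N e≤E with X ^ s in Xˢ-eq
... | zero = ≤-trans (≤-reflexive (trans (cong (λ t → suc L * (t * (N ^ s ∸ 0) ^ L) * N ^ s) Pˢ≡0)
                                          (cong (_* N ^ s) (*-zeroʳ (suc L))))) z≤n
  where
  Pˢ≡0 : P ^ s ≡ 0
  Pˢ≡0 = n≤0⇒n≡0 (≤-trans (^-monoˡ-≤ s (≤-trans (m≤m+n P E) (≤-reflexive P+E≡X))) (≤-reflexive Xˢ-eq))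
... | Xˢ@(suc _) = *-cancelʳ-≤ _ _ Xˢ (begin
  suc L * (P ^ s * (Nˢ ∸ Xˢ) ^ L) * Nˢ * Xˢ
    ≡⟨ solve 5 (λ l p w c x → l :* (p :* w) :* c :* x := (l :* x :* w) :* (p :* c)) refl (suc L) (P ^ s) ((Nˢ ∸ Xˢ) ^ L) Nˢ Xˢ ⟩
  suc L * Xˢ * (Nˢ ∸ Xˢ) ^ L * (P ^ s * Nˢ)
    ≤⟨ *-monoˡ-≤ (P ^ s * Nˢ) (one-success-≤ L Nˢ Xˢ Xˢ≤Nˢ) ⟩
  Nˢ ^ suc L * (P ^ s * Nˢ)
    ≡⟨ cong (Nˢ ^ suc L *_) (^-distribʳ-* P N s) ⟨
  Nˢ ^ suc L * (P * N) ^ s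
    ≤⟨ *-monoʳ-≤ (Nˢ ^ suc L) (^-monoˡ-≤ s (P*N≤[N∸e]*X P E X N e P+E≡X X≤N e≤E)) ⟩
  Nˢ ^ suc L * ((N ∸ e) * X) ^ s
    ≡⟨ cong (Nˢ ^ suc L *_) (trans (^-distribʳ-* (N ∸ e) X s) (cong ((N ∸ e) ^ s *_) Xˢ-eq)) ⟩
  Nˢ ^ suc L * ((N ∸ e) ^ s * Xˢ)
    ≡⟨ solve 3 (λ a b c → a :* (b :* c) := b :* a :* c) refl (Nˢ ^ suc L) ((N ∸ e) ^ s) Xˢ ⟩
  (N ∸ e) ^ s * Nˢ ^ suc L * Xˢ ∎)
  where
  open ≤-Reasoning
  Nˢ : ℕ
  Nˢ = N ^ s
  Xˢ≤Nˢ : Xˢ ≤ Nˢ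
  Xˢ≤Nˢ = ≤-trans (≤-reflexive (sym Xˢ-eq)) (^-monoˡ-≤ s X≤N)

-- Binomial coefficients

[1+n]C[1+k]*[1+k]≡[1+n]*nCk : ∀ n k → (suc n C suc k) * suc k ≡ suc n * (n C k)
[1+n]C[1+k]*[1+k]≡[1+n]*nCk zero zero = refl
[1+n]C[1+k]*[1+k]≡[1+n]*nCk zero (suc k) = refl
[1+n]C[1+k]*[1+k]≡[1+n]*nCk (suc n) zero = begin
  (suc (suc n) C 1) * 1 ≡⟨ *-identityʳ (suc (suc n) C 1) ⟩
  suc (suc n) C 1     ≡⟨ nC1≡n (suc (suc n)) ⟩
  suc (suc n)         ≡⟨ *-identityʳ (suc (suc n)) ⟨
  suc (suc n) * 1     ∎
  where open ≡-Reasoning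
[1+n]C[1+k]*[1+k]≡[1+n]*nCk (suc n) (suc k) = begin
  (suc (suc n) C suc (suc k)) * suc (suc k)
    ≡⟨ cong (_* suc (suc k)) (nCk+nC[k+1]≡[n+1]C[k+1] (suc n) (suc k)) ⟨
  (suc n C suc k + suc n C suc (suc k)) * suc (suc k)
    ≡⟨ solve 3 (λ x y k → (x :+ y) :* (con 2 :+ k) := x :* (con 1 :+ k) :+ x :+ y :* (con 2 :+ k))
               refl (suc n C suc k) (suc n C suc (suc k)) k ⟩
  (suc n C suc k) * suc k + suc n C suc k + (suc n C suc (suc k)) * suc (suc k)
    ≡⟨ cong₂ (λ x y → x + suc n C suc k + y) ([1+n]C[1+k]*[1+k]≡[1+n]*nCk n k) ([1+n]C[1+k]*[1+k]≡[1+n]*nCk n (suc k)) ⟩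
  suc n * (n C k) + suc n C suc k + suc n * (n C suc k)
    ≡⟨ solve 4 (λ n x y z → (con 1 :+ n) :* x :+ z :+ (con 1 :+ n) :* y := z :+ (con 1 :+ n) :* (x :+ y))
               refl n (n C k) (n C suc k) (suc n C suc k) ⟩
  suc n C suc k + suc n * (n C k + n C suc k)
    ≡⟨ cong (λ x → suc n C suc k + suc n * x) (nCk+nC[k+1]≡[n+1]C[k+1] n k) ⟩
  suc (suc n) * (suc n C suc k) ∎
  where open ≡-Reasoning

nCk≤[1+n]Ck : ∀ n k → n C k ≤ suc n C k
nCk≤[1+n]Ck n zero = ≤-refl
nCk≤[1+n]Ck n (suc k) = ≤-trans (m≤n+m (n C suc k) (n C k)) (≤-reflexive (nCk+nC[k+1]≡[n+1]C[k+1] n k))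

C-monoˡ-≤ : ∀ {m n} k → m ≤ n → m C k ≤ n C k
C-monoˡ-≤ {m} {n} k m≤n = subst (λ x → m C k ≤ x C k) (m∸n+n≡m m≤n) (grow (n ∸ m))
  where
  grow : ∀ d → m C k ≤ (d + m) C k
  grow zero = ≤-refl
  grow (suc d) = ≤-trans (grow d) (nCk≤[1+n]Ck (d + m) k)

dCa*v^a≤nCa*u^a : ∀ a d n u v → d * v ≤ n * u → u ≤ v → (d C a) * v ^ a ≤ (n C a) * u ^ a
dCa*v^a≤nCa*u^a zero d n u v _ _ = ≤-refl
dCa*v^a≤nCa*u^a (suc a) zero n u v _ _ = z≤n
dCa*v^a≤nCa*u^a (suc a) (suc d) zero u v dv≤0 _ = ≤-reflexive (trans (cong (λ t → (suc d C suc a) * (t * v ^ a)) v≡0) (*-zeroʳ (suc d C suc a)))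
  where
  v≡0 : v ≡ 0
  v≡0 = n≤0⇒n≡0 (≤-trans (m≤m+n v (d * v)) dv≤0)
dCa*v^a≤nCa*u^a (suc a) (suc d) (suc n) u v [1+d]v≤[1+n]u u≤v = *-cancelʳ-≤ _ _ (suc a) (begin
  (suc d C suc a) * (v * v ^ a) * suc a
    ≡⟨ solve 4 (λ b v w a → b :* (v :* w) :* a := b :* a :* v :* w) refl (suc d C suc a) v (v ^ a) (suc a) ⟩
  (suc d C suc a) * suc a * v * v ^ a
    ≡⟨ cong (λ t → t * v * v ^ a) ([1+n]C[1+k]*[1+k]≡[1+n]*nCk d a) ⟩
  suc d * (d C a) * v * v ^ a
    ≡⟨ solve 4 (λ d b v w → d :* b :* v :* w := d :* v :* (b :* w)) refl (suc d) (d C a) v (v ^ a) ⟩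
  suc d * v * ((d C a) * v ^ a)
    ≤⟨ *-mono-≤ [1+d]v≤[1+n]u (dCa*v^a≤nCa*u^a a d n u v dv≤nu u≤v) ⟩
  suc n * u * ((n C a) * u ^ a)
    ≡⟨ solve 4 (λ d b v w → d :* v :* (b :* w) := d :* b :* v :* w) refl (suc n) (n C a) u (u ^ a) ⟩
  suc n * (n C a) * u * u ^ a
    ≡⟨ cong (λ t → t * u * u ^ a) ([1+n]C[1+k]*[1+k]≡[1+n]*nCk n a) ⟨
  (suc n C suc a) * suc a * u * u ^ a
    ≡⟨ solve 4 (λ b v w a → b :* a :* v :* w := b :* (v :* w) :* a) refl (suc n C suc a) u (u ^ a) (suc a) ⟩
  (suc n C suc a) * (u * u ^ a) * suc a ∎)
  where
  open ≤-Reasoning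
  dv≤nu : d * v ≤ n * u
  dv≤nu = +-cancelˡ-≤ u (d * v) (n * u) (≤-trans (+-monoˡ-≤ (d * v) u≤v) [1+d]v≤[1+n]u)

-- The event S_T(x) = S_T(y) = {ℓ} for a fixed A

allTuples : (n s L : ℕ) → List (Tuples n s L)
allTuples n s L = vecs (vecs (allFin n) s) L

sharedSingleton : {n s L : ℕ} → Tuples n s L → Vec Bool n → Vec Bool n → Bool
sharedSingleton {L = L} T x y = any (λ ℓ → SIsSingleton T x ℓ ∧ SIsSingleton T y ℓ) (allFin L)

module _ {n : ℕ} (A x y : Vec Bool n) where

  ∈C ∈C∩x ∈C∩x∩y ∈C∩x∖y : Fin n → Bool
  ∈C j = not (lookup A j)
  ∈C∩x j = ∈C j ∧ lookup x j
  ∈C∩x∩y j = ∈C j ∧ (lookup x j ∧ lookup y j)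
  ∈C∩x∖y j = ∈C j ∧ (lookup x j ∧ not (lookup y j))

  #C∩x∩y+#C∩x∖y≡#C∩x : countFin ∈C∩x∩y + countFin ∈C∩x∖y ≡ countFin ∈C∩x
  #C∩x∩y+#C∩x∖y≡#C∩x = sym (countFin-+ ∈C∩x ∈C∩x∩y ∈C∩x∖y (λ j → split (∈C j) (lookup x j) (lookup y j)))
    where
    split : ∀ c u v → toℕ (c ∧ u) ≡ toℕ (c ∧ (u ∧ v)) + toℕ (c ∧ (u ∧ not v))
    split true true true = refl
    split true true false = refl
    split true false _ = refl
    split false _ _ = refl

  #C∩x≤#C : countFin ∈C∩x ≤ countFin ∈C
  #C∩x≤#C = ≤-trans (m≤m+n _ _) (≤-reflexive (sym (countFin-+ ∈C ∈C∩x (λ j → ∈C j ∧ not (lookup x j))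
    (λ j → split (∈C j) (lookup x j)))))
    where
    split : ∀ c u → toℕ c ≡ toℕ (c ∧ u) + toℕ (c ∧ not u)
    split true true = refl
    split true false = refl
    split false _ = refl

  allIn : (Fin n → Bool) → Vec (Fin n) s → Bool
  allIn p v = all p (toList v)

  shape : Fin (suc L) → Fin (suc L) → Vec (Fin n) s → Bool
  shape ℓ i = if does (i ≟ ℓ) then allIn ∈C∩x∩y else (λ v → allIn ∈C v ∧ not (allIn ∈C∩x v))

  allIn-∈C∩x⇒∈C : (v : Vec (Fin n) s) → allIn ∈C∩x v ≡ true → allIn ∈C v ≡ true
  allIn-∈C∩x⇒∈C v holds with allIn ∈C v in inC-v
  ... | true = refl
  ... | false = trans (sym (trans (all-∧ ∈C (lookup x) (toList v)) (cong (_∧ all (lookup x) (toList v)) inC-v))) holds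

  shared⇒shape : (ℓ : Fin (suc L)) (T : Tuples n s (suc L)) →
    inC A T ∧ (SIsSingleton T x ℓ ∧ SIsSingleton T y ℓ) ≡ true → allAt (shape ℓ) T ≡ true
  shared⇒shape ℓ T holds = allAt-intro (shape ℓ) T fits
    where
    inC-T : inC A T ≡ true
    inC-T = proj₁ (∧≡true⁻ (inC A T) holds)
    single-xy : SIsSingleton T x ℓ ∧ SIsSingleton T y ℓ ≡ true
    single-xy = proj₂ (∧≡true⁻ (inC A T) holds)
    single-x : SIsSingleton T x ℓ ≡ true
    single-x = proj₁ (∧≡true⁻ (SIsSingleton T x ℓ) single-xy)
    single-y : SIsSingleton T y ℓ ≡ true
    single-y = proj₂ (∧≡true⁻ (SIsSingleton T x ℓ) single-xy)
    inC-at : ∀ i → allIn ∈C (lookup T i) ≡ true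
    inC-at = allAt-elim (λ _ → allIn ∈C) T (trans (sym (all-toList (allIn ∈C) T)) inC-T)
    singleton-at : (z : Vec Bool n) → SIsSingleton T z ℓ ≡ true → ∀ i → iff (inS T z i) (does (i ≟ ℓ)) ≡ true
    singleton-at z single = allFinᵇ-elim _ (trans (sym (all-allFin (λ i → iff (inS T z i) (does (i ≟ ℓ))))) single)
    fits : ∀ i → shape ℓ i (lookup T i) ≡ true
    fits i with inC-at i | singleton-at x single-x i | singleton-at y single-y i
    ... | inC-i | x-i | y-i with i ≟ ℓ
    ...   | yes refl = begin
      all (λ j → ∈C j ∧ (lookup x j ∧ lookup y j)) v
        ≡⟨ all-∧ ∈C _ v ⟩
      allIn ∈C (lookup T i) ∧ all (λ j → lookup x j ∧ lookup y j) v
        ≡⟨ cong₂ _∧_ inC-i (all-∧ (lookup x) (lookup y) v) ⟩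
      true ∧ (inS T x i ∧ inS T y i)
        ≡⟨ cong₂ _∧_ (trans (sym (iff-trueʳ (inS T x i))) x-i) (trans (sym (iff-trueʳ (inS T y i))) y-i) ⟩
      true ∎
      where
      open ≡-Reasoning
      v : List (Fin n)
      v = toList (lookup T i)
    ...   | no _ = cong₂ _∧_ inC-i (cong not (trans (all-∧ ∈C (lookup x) (toList (lookup T i)))
                                                   (cong₂ _∧_ inC-i (iff-falseʳ _ x-i))))

  countᵇ-shape : (ℓ : Fin (suc L)) → countᵇ (allAt (shape ℓ)) (allTuples n s (suc L))
    ≡ countFin ∈C∩x∩y ^ s * (countFin ∈C ^ s ∸ countFin ∈C∩x ^ s) ^ L
  countᵇ-shape {L = L} {s = s} ℓ = begin
    countᵇ (allAt (shape ℓ)) (allTuples n s (suc L))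
      ≡⟨ countᵇ-allAt (shape ℓ) tuples ⟩
    ∏ (λ i → countᵇ (shape ℓ i) tuples)
      ≡⟨ ∏-cong (λ i → countᵇ-if (does (i ≟ ℓ))) ⟩
    ∏ (λ i → if does (i ≟ ℓ) then countᵇ (allIn ∈C∩x∩y) tuples else countᵇ inC∖inX tuples)
      ≡⟨ ∏-single ℓ _ _ ⟩
    countᵇ (allIn ∈C∩x∩y) tuples * countᵇ inC∖inX tuples ^ L
      ≡⟨ cong₂ (λ u w → u * w ^ L) (countᵇ-allIn ∈C∩x∩y) countᵇ-inC∖inX ⟩
    countFin ∈C∩x∩y ^ s * (countFin ∈C ^ s ∸ countFin ∈C∩x ^ s) ^ L ∎
    where
    open ≡-Reasoning
    tuples : List (Vec (Fin n) s)
    tuples = vecs (allFin n) s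
    inC∖inX : Vec (Fin n) s → Bool
    inC∖inX v = allIn ∈C v ∧ not (allIn ∈C∩x v)
    countᵇ-if : (b : Bool) → countᵇ (if b then allIn ∈C∩x∩y else inC∖inX) tuples
                             ≡ (if b then countᵇ (allIn ∈C∩x∩y) tuples else countᵇ inC∖inX tuples)
    countᵇ-if true = refl
    countᵇ-if false = refl
    countᵇ-allIn : (p : Fin n → Bool) → countᵇ (allIn p) tuples ≡ countFin p ^ s
    countᵇ-allIn p = trans (countᵇ-all-vecs s p (allFin n)) (cong (_^ s) (countᵇ-allFin p))
    countᵇ-inC∖inX : countᵇ inC∖inX tuples ≡ countFin ∈C ^ s ∸ countFin ∈C∩x ^ s
    countᵇ-inC∖inX = trans (sym (m+n∸n≡m _ (countᵇ (allIn ∈C∩x) tuples)))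
      (cong₂ _∸_ (trans (countᵇ-∧-not allIn-∈C∩x⇒∈C tuples) (countᵇ-allIn ∈C)) (countᵇ-allIn ∈C∩x))

  countᵇ-shared-≤ : countᵇ (λ T → inC A T ∧ sharedSingleton T x y) (allTuples n s (suc L))
    ≤ suc L * (countFin ∈C∩x∩y ^ s * (countFin ∈C ^ s ∸ countFin ∈C∩x ^ s) ^ L)
  countᵇ-shared-≤ {s = s} {L = L} = begin
    countᵇ (λ T → inC A T ∧ sharedSingleton T x y) tuples
      ≡⟨ countᵇ-cong (λ T → ∧-any (inC A T) _ (allFin (suc L))) tuples ⟩
    countᵇ (λ T → any (λ ℓ → event ℓ T) (allFin (suc L))) tuples
      ≤⟨ countᵇ-any event (allFin (suc L)) tuples ⟩
    sum (map (λ ℓ → countᵇ (event ℓ) tuples) (allFin (suc L)))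
      ≤⟨ sum-mono-≤ (λ ℓ → countᵇ-mono (shared⇒shape ℓ) tuples) (allFin (suc L)) ⟩
    sum (map (λ ℓ → countᵇ (allAt (shape ℓ)) tuples) (allFin (suc L)))
      ≡⟨ cong sum (map-cong countᵇ-shape (allFin (suc L))) ⟩
    sum (map (λ _ → K) (allFin (suc L)))
      ≡⟨ sum-const K (allFin (suc L)) ⟩
    length (allFin (suc L)) * K
      ≡⟨ cong (_* K) (length-tabulate {n = suc L} (λ i → i)) ⟩
    suc L * K ∎
    where
    open ≤-Reasoning
    tuples : List (Tuples n s (suc L))
    tuples = allTuples n s (suc L)
    K : ℕ
    K = countFin ∈C∩x∩y ^ s * (countFin ∈C ^ s ∸ countFin ∈C∩x ^ s) ^ L
    event : Fin (suc L) → Tuples n s (suc L) → Bool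
    event ℓ T = inC A T ∧ (SIsSingleton T x ℓ ∧ SIsSingleton T y ℓ)

  countᵇ-shared*C^s≤ : (e : ℕ) → e ≤ countFin ∈C∩x∖y →
    countᵇ (λ T → inC A T ∧ sharedSingleton T x y) (allTuples n s L) * countFin ∈C ^ s
      ≤ (countFin ∈C ∸ e) ^ s * (countFin ∈C ^ s) ^ L
  countᵇ-shared*C^s≤ {s = s} {L = zero} e _ = ≤-trans
    (≤-reflexive (cong (_* countFin ∈C ^ s) (countᵇ-none (λ T → ∧-zeroʳ (inC A T)) (allTuples n s 0)))) z≤n
  countᵇ-shared*C^s≤ {s = s} {L = suc L} e e≤ = ≤-trans
    (*-monoˡ-≤ (countFin ∈C ^ s) (countᵇ-shared-≤ {s = s} {L = L}))
    (singleton-bound s L (countFin ∈C∩x∩y) (countFin ∈C∩x∖y) (countFin ∈C∩x) (countFin ∈C) e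
                     #C∩x∩y+#C∩x∖y≡#C∩x #C∩x≤#C e≤)

-- The probability of Bad for a fixed pair x, y

badPair : Vec Bool n → Vec Bool n → Vec Bool n × Tuples n s L → Bool
badPair {L = L} x y (A , T) = any (λ ℓ → SIsSingleton T x ℓ ∧ SIsSingleton T y ℓ ∧ complementOn A x y) (allFin L)

badPair≡complementOn∧shared : (x y A : Vec Bool n) (T : Tuples n s L) →
  badPair x y (A , T) ≡ complementOn A x y ∧ sharedSingleton T x y
badPair≡complementOn∧shared {L = L} x y A T with complementOn A x y
... | true = any-cong (λ ℓ → cong (SIsSingleton T x ℓ ∧_) (∧-identityʳ _)) (allFin L)
... | false = trans (any-cong (λ ℓ → trans (cong (SIsSingleton T x ℓ ∧_) (∧-zeroʳ _)) (∧-zeroʳ _)) (allFin L))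
                    (none (allFin L))
  where
  none : (ℓs : List (Fin L)) → any (λ _ → false) ℓs ≡ false
  none [] = refl
  none (_ ∷ ℓs) = none ℓs

countᵇ-sampleSpace : (p : Vec Bool n × Tuples n s L → Bool) → countᵇ p (sampleSpace n a s L)
  ≡ sum (map (λ A → countᵇ (λ T → inC A T ∧ p (A , T)) (allTuples n s L)) (subsetsOfSize n a))
countᵇ-sampleSpace {n} {s} {L} {a} p = trans (countᵇ-concatMap p _ (subsetsOfSize n a))
  (cong sum (map-cong (λ A → trans (countᵇ-map p (A ,_) (filterᵇ (inC A) (allTuples n s L)))
                                   (countᵇ-filterᵇ (λ T → p (A , T)) (inC A) (allTuples n s L)))
                      (subsetsOfSize n a)))

countᵇ-inC : (A : Vec Bool n) → weight A ≡ a → countᵇ (inC A) (allTuples n s L) ≡ ((n ∸ a) ^ s) ^ L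
countᵇ-inC {n} {a} {s} {L} A |A|≡a = begin
  countᵇ (inC A) (allTuples n s L)
    ≡⟨ countᵇ-all-vecs L (λ v → all ∈A̅ (toList v)) (vecs (allFin n) s) ⟩
  countᵇ (λ v → all ∈A̅ (toList v)) (vecs (allFin n) s) ^ L
    ≡⟨ cong (_^ L) (countᵇ-all-vecs s ∈A̅ (allFin n)) ⟩
  (countᵇ ∈A̅ (allFin n) ^ s) ^ L
    ≡⟨ cong (λ m → (m ^ s) ^ L) (trans (countᵇ-allFin ∈A̅) (countFin-not-lookup A)) ⟩
  ((n ∸ weight A) ^ s) ^ L
    ≡⟨ cong (λ w → ((n ∸ w) ^ s) ^ L) |A|≡a ⟩
  ((n ∸ a) ^ s) ^ L ∎
  where
  open ≡-Reasoning
  ∈A̅ : Fin n → Bool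
  ∈A̅ j = not (lookup A j)

totalCount≡ : (n a s L : ℕ) → totalCount n a s L ≡ (n C a) * ((n ∸ a) ^ s) ^ L
totalCount≡ n a s L = begin
  length (sampleSpace n a s L)
    ≡⟨ length-concatMap _ (subsetsOfSize n a) ⟩
  sum (map (λ A → length (map (A ,_) (filterᵇ (inC A) (allTuples n s L)))) (subsetsOfSize n a))
    ≡⟨ cong sum (map-cong (λ A → length-map (A ,_) (filterᵇ (inC A) (allTuples n s L))) (subsetsOfSize n a)) ⟩
  sum (map (λ A → countᵇ (inC A) (allTuples n s L)) (subsetsOfSize n a))
    ≡⟨ sum-filterᵇ-const _ (λ A → weight A == a) _ (λ A eq → countᵇ-inC {s = s} {L = L} A (==⇒≡ (weight A) a eq)) (vecs bits n) ⟩
  countᵇ (λ A → weight A == a) (vecs bits n) * ((n ∸ a) ^ s) ^ L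
    ≡⟨ cong (_* ((n ∸ a) ^ s) ^ L) #subsets ⟩
  (n C a) * ((n ∸ a) ^ s) ^ L ∎
  where
  open ≡-Reasoning
  ⊆-everything : (A : Vec Bool n) → (A ⊆ᵇ λ _ → true) ≡ true
  ⊆-everything A = allFinᵇ-intro _ (λ i → ∨-zeroʳ (not (lookup A i)))
  #subsets : countᵇ (λ A → weight A == a) (vecs bits n) ≡ n C a
  #subsets = begin
    countᵇ (λ A → weight A == a) (vecs bits n)
      ≡⟨ countᵇ-cong (λ A → trans (sym (∧-identityʳ _)) (cong ((weight A == a) ∧_) (sym (⊆-everything A)))) (vecs bits n) ⟩
    countᵇ (λ A → (weight A == a) ∧ A ⊆ᵇ (λ _ → true)) (vecs bits n)
      ≡⟨ countᵇ-subsets-⊆ {n = n} (λ _ → true) a ⟩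
    countFin {n} (λ _ → true) C a
      ≡⟨ cong (_C a) (countFin-true n) ⟩
    n C a ∎

diffCount hamming : Vec Bool n → Vec Bool n → ℕ
diffCount x y = countFin (λ j → lookup x j ∧ not (lookup y j))

hamming x y = countFin (λ j → lookup x j xor lookup y j)

-- A lower bound for |C ∩ (x ∖ y)| in the better of the two orientations, since |A| = a.
excess : ℕ → Vec Bool n → Vec Bool n → ℕ
excess a x y = (diffCount x y ⊔ diffCount y x) ∸ a

hamming≤2*excess+2*a : (a : ℕ) (x y : Vec Bool n) → hamming x y ≤ 2 * excess a x y + 2 * a
hamming≤2*excess+2*a a x y = begin
  hamming x y                   ≡⟨ countFin-+ _ _ _ (λ j → split (lookup x j) (lookup y j)) ⟩
  diffCount x y + diffCount y x ≤⟨ +-mono-≤ (m≤m⊔n (diffCount x y) _) (m≤n⊔m _ (diffCount y x)) ⟩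
  M + M                         ≤⟨ +-mono-≤ M≤e+a M≤e+a ⟩
  (M ∸ a + a) + (M ∸ a + a)     ≡⟨ cong ((M ∸ a + a) +_) (sym (+-identityʳ _)) ⟩
  2 * (M ∸ a + a)               ≡⟨ *-distribˡ-+ 2 (M ∸ a) a ⟩
  2 * excess a x y + 2 * a      ∎
  where
  open ≤-Reasoning
  M : ℕ
  M = diffCount x y ⊔ diffCount y x
  M≤e+a : M ≤ M ∸ a + a
  M≤e+a = ≤-trans (m≤n+m∸n M a) (≤-reflexive (+-comm a (M ∸ a)))
  split : ∀ u v → toℕ (u xor v) ≡ toℕ (u ∧ not v) + toℕ (v ∧ not u)
  split true true = refl
  split true false = refl
  split false true = refl
  split false false = refl

diffCount∸a≤#C∩x∖y : (A x y : Vec Bool n) → weight A ≡ a → diffCount x y ∸ a ≤ countFin (∈C∩x∖y A x y)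
diffCount∸a≤#C∩x∖y {a = a} A x y |A|≡a = m≤n+o⇒m∸n≤o (diffCount x y) a (≤-trans
  (countFin-≤-+ _ (lookup A) _ (λ j → cover (lookup A j) (lookup x j ∧ not (lookup y j))))
  (≤-reflexive (cong (_+ _) (trans (countFin-lookup A) |A|≡a))))
  where
  cover : ∀ u b → toℕ b ≤ toℕ u + toℕ (not u ∧ b)
  cover true true = s≤s z≤n
  cover true false = z≤n
  cover false b = ≤-refl

sharedSingleton-comm : (T : Tuples n s L) (x y : Vec Bool n) → sharedSingleton T x y ≡ sharedSingleton T y x
sharedSingleton-comm {L = L} T x y = any-cong (λ ℓ → ∧-comm (SIsSingleton T x ℓ) _) (allFin L)

countᵇ-shared*C^s≤-excess : (A x y : Vec Bool n) → weight A ≡ a →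
  countᵇ (λ T → inC A T ∧ sharedSingleton T x y) (allTuples n s L) * (n ∸ a) ^ s
    ≤ (n ∸ a ∸ excess a x y) ^ s * ((n ∸ a) ^ s) ^ L
countᵇ-shared*C^s≤-excess {n} {a} {s} {L} A x y |A|≡a = orient (diffCount y x ≤? diffCount x y)
  where
  #C≡n∸a : countFin (λ j → not (lookup A j)) ≡ n ∸ a
  #C≡n∸a = trans (countFin-not-lookup A) (cong (n ∸_) |A|≡a)
  via : (u v : Vec Bool n) → excess a x y ≤ countFin (∈C∩x∖y A u v) →
    countᵇ (λ T → inC A T ∧ sharedSingleton T u v) (allTuples n s L) * (n ∸ a) ^ s
      ≤ (n ∸ a ∸ excess a x y) ^ s * ((n ∸ a) ^ s) ^ L
  via u v e≤ = subst (λ c → countᵇ (λ T → inC A T ∧ sharedSingleton T u v) (allTuples n s L) * c ^ s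
                              ≤ (c ∸ excess a x y) ^ s * (c ^ s) ^ L)
                     #C≡n∸a (countᵇ-shared*C^s≤ A u v {s = s} {L = L} (excess a x y) e≤)
  orient : Dec (diffCount y x ≤ diffCount x y) →
    countᵇ (λ T → inC A T ∧ sharedSingleton T x y) (allTuples n s L) * (n ∸ a) ^ s
      ≤ (n ∸ a ∸ excess a x y) ^ s * ((n ∸ a) ^ s) ^ L
  orient (yes y∖x≤x∖y) = via x y (subst (_≤ countFin (∈C∩x∖y A x y)) (cong (_∸ a) (sym (m≥n⇒m⊔n≡m y∖x≤x∖y)))
                                         (diffCount∸a≤#C∩x∖y A x y |A|≡a))
  orient (no y∖x≰x∖y) = subst (λ c → c * (n ∸ a) ^ s ≤ _)
    (countᵇ-cong (λ T → cong (inC A T ∧_) (sharedSingleton-comm T y x)) (allTuples n s L))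
    (via y x (subst (_≤ countFin (∈C∩x∖y A y x)) (cong (_∸ a) (sym (m≤n⇒m⊔n≡n (<⇒≤ (≰⇒> y∖x≰x∖y)))))
                           (diffCount∸a≤#C∩x∖y A y x |A|≡a)))

countᵇ-badPair*C^s≤ : (x y : Vec Bool n) → countᵇ (badPair x y) (sampleSpace n a s L) * (n ∸ a) ^ s
  ≤ (hamming x y C a) * ((n ∸ a ∸ excess a x y) ^ s * ((n ∸ a) ^ s) ^ L)
countᵇ-badPair*C^s≤ {n} {a} {s} {L} x y = begin
  countᵇ (badPair x y) (sampleSpace n a s L) * (n ∸ a) ^ s
    ≡⟨ cong (_* (n ∸ a) ^ s) (countᵇ-sampleSpace (badPair x y)) ⟩
  sum (map perSubset (subsetsOfSize n a)) * (n ∸ a) ^ s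
    ≡⟨ sum-*ʳ ((n ∸ a) ^ s) perSubset (subsetsOfSize n a) ⟨
  sum (map (λ A → perSubset A * (n ∸ a) ^ s) (subsetsOfSize n a))
    ≤⟨ sum-filterᵇ-≤ _ (λ A → weight A == a) (λ A → complementOn A x y) Bound perSubset-≤ (vecs bits n) ⟩
  countᵇ (λ A → complementOn A x y) (subsetsOfSize n a) * Bound
    ≡⟨ cong (_* Bound) (countᵇ-filterᵇ _ (λ A → weight A == a) (vecs bits n)) ⟩
  countᵇ (λ A → (weight A == a) ∧ complementOn A x y) (vecs bits n) * Bound
    ≡⟨ cong (_* Bound) (countᵇ-cong (λ A → cong ((weight A == a) ∧_) (all-allFin {n = n} _)) (vecs bits n)) ⟩
  countᵇ (λ A → (weight A == a) ∧ A ⊆ᵇ (λ j → lookup x j xor lookup y j)) (vecs bits n) * Bound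
    ≡⟨ cong (_* Bound) (countᵇ-subsets-⊆ {n = n} _ a) ⟩
  (hamming x y C a) * Bound ∎
  where
  open ≤-Reasoning
  Bound : ℕ
  Bound = (n ∸ a ∸ excess a x y) ^ s * ((n ∸ a) ^ s) ^ L
  perSubset : Vec Bool n → ℕ
  perSubset A = countᵇ (λ T → inC A T ∧ badPair x y (A , T)) (allTuples n s L)
  perSubset-≤ : (A : Vec Bool n) → (weight A == a) ≡ true → perSubset A * (n ∸ a) ^ s ≤ toℕ (complementOn A x y) * Bound
  perSubset-≤ A |A|==a = bound (complementOn A x y) refl
    where
    perSubset≡ : complementOn A x y ≡ true →
      perSubset A ≡ countᵇ (λ T → inC A T ∧ sharedSingleton T x y) (allTuples n s L)
    perSubset≡ compl = countᵇ-cong (λ T → cong (inC A T ∧_)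
      (trans (badPair≡complementOn∧shared x y A T) (cong (_∧ sharedSingleton T x y) compl))) (allTuples n s L)
    perSubset≡0 : complementOn A x y ≡ false → perSubset A ≡ 0
    perSubset≡0 compl = countᵇ-none (λ T → trans (cong (inC A T ∧_)
      (trans (badPair≡complementOn∧shared x y A T) (cong (_∧ sharedSingleton T x y) compl))) (∧-zeroʳ _)) (allTuples n s L)
    bound : (c : Bool) → complementOn A x y ≡ c → perSubset A * (n ∸ a) ^ s ≤ toℕ c * Bound
    bound false compl = ≤-reflexive (cong (_* (n ∸ a) ^ s) (perSubset≡0 compl))
    bound true compl = begin
      perSubset A * (n ∸ a) ^ s
        ≡⟨ cong (_* (n ∸ a) ^ s) (perSubset≡ compl) ⟩
      countᵇ (λ T → inC A T ∧ sharedSingleton T x y) (allTuples n s L) * (n ∸ a) ^ s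
        ≤⟨ countᵇ-shared*C^s≤-excess {s = s} {L = L} A x y (==⇒≡ (weight A) a |A|==a) ⟩
      Bound ≡⟨ +-identityʳ Bound ⟨
      1 * Bound ∎

badCount≤∑badPair : (n a s L : ℕ) (Q : List (Vec Bool n)) →
  badCount n a s L Q ≤ sum (map (λ x → sum (map (λ y → countᵇ (badPair x y) (sampleSpace n a s L)) Q)) Q)
badCount≤∑badPair n a s L Q = begin
  countᵇ (Bad Q) SS
    ≤⟨ countᵇ-any (λ x z → any (λ y → badPair x y z) Q) Q SS ⟩
  sum (map (λ x → countᵇ (λ z → any (λ y → badPair x y z) Q) SS) Q)
    ≤⟨ sum-mono-≤ (λ x → countᵇ-any (λ y → badPair x y) Q SS) Q ⟩
  sum (map (λ x → sum (map (λ y → countᵇ (badPair x y) SS) Q)) Q) ∎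
  where
  open ≤-Reasoning
  SS : List (Vec Bool n × Tuples n s L)
  SS = sampleSpace n a s L

k*badCount≤totalCount : (n a s L k q : ℕ) (Q : List (Vec Bool n)) → length Q ≡ q → 1 ≤ n ∸ a →
  (∀ (x y : Vec Bool n) → k * (q * q) * (hamming x y C a) * (n ∸ a ∸ excess a x y) ^ s ≤ (n C a) * (n ∸ a) ^ s) →
  k * badCount n a s L Q ≤ totalCount n a s L
k*badCount≤totalCount n a s L k _ [] refl _ _ =
  ≤-trans (≤-reflexive (trans (cong (k *_) (countᵇ-none (λ _ → refl) (sampleSpace n a s L))) (*-zeroʳ k))) z≤n
k*badCount≤totalCount n a s L k q Q@(_ ∷ _) refl 1≤#C pair-≤ = *-cancelʳ-≤ _ _ (q * q) (begin
  k * badCount n a s L Q * (q * q)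
    ≡⟨ solve 3 (λ k b q → k :* b :* (q :* q) := (k :* (q :* q)) :* b) refl k (badCount n a s L Q) q ⟩
  K * badCount n a s L Q
    ≤⟨ *-monoʳ-≤ K (badCount≤∑badPair n a s L Q) ⟩
  K * sum (map (λ x → sum (map (λ y → countᵇ (badPair x y) SS) Q)) Q)
    ≡⟨ sum-*ˡ K _ Q ⟨
  sum (map (λ x → K * sum (map (λ y → countᵇ (badPair x y) SS) Q)) Q)
    ≡⟨ cong sum (map-cong (λ x → sum-*ˡ K _ Q) Q) ⟨
  sum (map (λ x → sum (map (λ y → K * countᵇ (badPair x y) SS) Q)) Q)
    ≤⟨ double-sum-≤ _ total K*badPair≤total Q ⟩
  q * (q * total)
    ≡⟨ solve 2 (λ q t → q :* (q :* t) := t :* (q :* q)) refl q total ⟩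
  total * (q * q) ∎)
  where
  open ≤-Reasoning
  K total #C : ℕ
  K = k * (q * q)
  total = totalCount n a s L
  #C = n ∸ a
  SS : List (Vec Bool n × Tuples n s L)
  SS = sampleSpace n a s L
  instance
    #Cˢ≢0 : NonZero (#C ^ s)
    #Cˢ≢0 = >-nonZero (1≤m^n #C s 1≤#C)
  K*badPair≤total : ∀ x y → K * countᵇ (badPair x y) SS ≤ total
  K*badPair≤total x y = *-cancelʳ-≤ _ _ (#C ^ s) (begin
    K * countᵇ (badPair x y) SS * #C ^ s
      ≡⟨ *-assoc K _ (#C ^ s) ⟩
    K * (countᵇ (badPair x y) SS * #C ^ s)
      ≤⟨ *-monoʳ-≤ K (countᵇ-badPair*C^s≤ x y) ⟩
    K * ((hamming x y C a) * ((#C ∸ e) ^ s * (#C ^ s) ^ L))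
      ≡⟨ solve 4 (λ k b e t → k :* (b :* (e :* t)) := k :* b :* e :* t) refl K (hamming x y C a) ((#C ∸ e) ^ s) ((#C ^ s) ^ L) ⟩
    K * (hamming x y C a) * (#C ∸ e) ^ s * (#C ^ s) ^ L
      ≤⟨ *-monoˡ-≤ ((#C ^ s) ^ L) (pair-≤ x y) ⟩
    (n C a) * #C ^ s * (#C ^ s) ^ L
      ≡⟨ solve 3 (λ b c t → b :* c :* t := b :* t :* c) refl (n C a) (#C ^ s) ((#C ^ s) ^ L) ⟩
    (n C a) * (#C ^ s) ^ L * #C ^ s
      ≡⟨ cong (_* #C ^ s) (totalCount≡ n a s L) ⟨
    total * #C ^ s ∎)
    where
    e : ℕ
    e = excess a x y

-- Asymptotic estimates

-- Opaque, so that the type checker never unfolds these numerals inside products with variables.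
opaque
  2⁴⁹⁰ 2¹⁰⁰⁰ 2¹⁰¹⁰ : ℕ
  2⁴⁹⁰ = 2 ^ 490
  2¹⁰⁰⁰ = 2 ^ 1000
  2¹⁰¹⁰ = 2 ^ 1010

opaque
  unfolding 2⁴⁹⁰ 2¹⁰⁰⁰ 2¹⁰¹⁰

  2^490≡2⁴⁹⁰ : 2 ^ 490 ≡ 2⁴⁹⁰
  2^490≡2⁴⁹⁰ = refl

  2^1000≡2¹⁰⁰⁰ : 2 ^ 1000 ≡ 2¹⁰⁰⁰
  2^1000≡2¹⁰⁰⁰ = refl

  1≤2¹⁰⁰⁰ : 1 ≤ 2¹⁰⁰⁰
  1≤2¹⁰⁰⁰ = ≤ᵇ⇒≤ 1 2¹⁰⁰⁰ _

  4≤2¹⁰¹⁰ : 4 ≤ 2¹⁰¹⁰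
  4≤2¹⁰¹⁰ = ≤ᵇ⇒≤ 4 2¹⁰¹⁰ _

  2⁴⁹⁰≤2¹⁰¹⁰ : 2⁴⁹⁰ ≤ 2¹⁰¹⁰
  2⁴⁹⁰≤2¹⁰¹⁰ = ≤ᵇ⇒≤ 2⁴⁹⁰ 2¹⁰¹⁰ _

  2¹⁰⁰⁰*4≤2¹⁰¹⁰ : 2¹⁰⁰⁰ * 4 ≤ 2¹⁰¹⁰
  2¹⁰⁰⁰*4≤2¹⁰¹⁰ = ≤ᵇ⇒≤ (2¹⁰⁰⁰ * 4) 2¹⁰¹⁰ _

module Estimates (k n r a s q : ℕ) (1≤k : 1 ≤ k) (2¹⁰¹⁰k≤r : 2¹⁰¹⁰ * k ≤ r)
                 (r¹⁰⁰⁰≤n : r ^ 1000 ≤ n) (n<[r+1]¹⁰⁰⁰ : n < (r + 1) ^ 1000)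
                 (1≤a : 1 ≤ a) (a¹⁰⁰≤n⁴⁹ : a ^ 100 ≤ n ^ 49)
                 (s²≤n∸a : s * s ≤ n ∸ a) (n∸a<[1+s]² : n ∸ a < suc s * suc s)
                 (q¹⁰⁰⁰≤nᵃ : q ^ 1000 ≤ n ^ a) where

  open ≤-Reasoning

  c*k≤r : ∀ c → c ≤ 2¹⁰¹⁰ → c * k ≤ r
  c*k≤r c c≤ = ≤-trans (*-monoˡ-≤ k c≤) 2¹⁰¹⁰k≤r

  c≤r : ∀ c → c ≤ 2¹⁰¹⁰ → c ≤ r
  c≤r c c≤ = ≤-trans (≤-trans (≤-reflexive (sym (*-identityʳ c))) (*-monoʳ-≤ c 1≤k)) (c*k≤r c c≤)

  k≤r : k ≤ r
  k≤r = ≤-trans (≤-reflexive (sym (*-identityˡ k))) (c*k≤r 1 (≤-trans (s≤s z≤n) 4≤2¹⁰¹⁰))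

  1≤r : 1 ≤ r
  1≤r = ≤-trans 1≤k k≤r

  n<[2r]¹⁰⁰⁰ : n < (2 * r) ^ 1000
  n<[2r]¹⁰⁰⁰ = <-≤-trans n<[r+1]¹⁰⁰⁰ (^-monoˡ-≤ 1000 r+1≤2r)
    where
    r+1≤2r : r + 1 ≤ 2 * r
    r+1≤2r = ≤-trans (+-monoʳ-≤ r 1≤r) (≤-reflexive (cong (r +_) (sym (+-identityʳ r))))

  a<2⁴⁹⁰*r^490 : a < 2⁴⁹⁰ * r ^ 490
  a<2⁴⁹⁰*r^490 = ^-cancelˡ-< 100 a _ (begin-strict
    a ^ 100                           ≤⟨ a¹⁰⁰≤n⁴⁹ ⟩
    n ^ 49                            <⟨ ^-monoˡ-< 49 n<[2r]¹⁰⁰⁰ ⟩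
    ((2 * r) ^ 1000) ^ 49             ≡⟨ trans (^-*-assoc (2 * r) 1000 49) (sym (^-*-assoc (2 * r) 490 100)) ⟩
    ((2 * r) ^ 490) ^ 100             ≡⟨ cong (_^ 100) (trans (^-distribʳ-* 2 r 490) (cong (_* r ^ 490) 2^490≡2⁴⁹⁰)) ⟩
    (2⁴⁹⁰ * r ^ 490) ^ 100            ∎)

  a≤r^491 : a ≤ r ^ 491
  a≤r^491 = ≤-trans (<⇒≤ a<2⁴⁹⁰*r^490) (*-monoˡ-≤ (r ^ 490) (c≤r 2⁴⁹⁰ 2⁴⁹⁰≤2¹⁰¹⁰))

  2≤r^2 : 2 ≤ r ^ 2
  2≤r^2 = ≤-trans (c≤r 2 (≤-trans (s≤s (s≤s z≤n)) 4≤2¹⁰¹⁰)) (m≤m^n r 2 1≤r (s≤s z≤n))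

  r^998≤n∸a : r ^ 998 ≤ n ∸ a
  r^998≤n∸a = m+n≤o⇒m≤o∸n (r ^ 998) (begin
    r ^ 998 + a           ≤⟨ +-monoʳ-≤ (r ^ 998) (≤-trans a≤r^491 (m^n≤m^[n+o] r 491 507 1≤r)) ⟩
    r ^ 998 + r ^ 998     ≡⟨ cong (r ^ 998 +_) (+-identityʳ _) ⟨
    2 * r ^ 998           ≤⟨ *-monoˡ-≤ (r ^ 998) 2≤r^2 ⟩
    r ^ 2 * r ^ 998       ≡⟨ ^-distribˡ-+-* r 2 998 ⟨
    r ^ 1000              ≤⟨ r¹⁰⁰⁰≤n ⟩
    n                     ∎)

  r^499≤s : r ^ 499 ≤ s
  r^499≤s = s≤s⁻¹ (^-cancelˡ-< 2 (r ^ 499) (suc s) (begin-strict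
    (r ^ 499) ^ 2         ≡⟨ ^-*-assoc r 499 2 ⟩
    r ^ 998               ≤⟨ r^998≤n∸a ⟩
    n ∸ a                 <⟨ n∸a<[1+s]² ⟩
    suc s * suc s         ≡⟨ cong (suc s *_) (*-identityʳ (suc s)) ⟨
    suc s ^ 2             ∎))

  1≤n∸a : 1 ≤ n ∸ a
  1≤n∸a = ≤-trans (1≤m^n r 998 1≤r) r^998≤n∸a

  b : ℕ
  b = r ^ 496

  [kq²]^500≡k^500*q^1000 : (k * (q * q)) ^ 500 ≡ k ^ 500 * q ^ 1000
  [kq²]^500≡k^500*q^1000 = trans (^-distribʳ-* k (q * q) 500)
    (cong (k ^ 500 *_) (trans (^-distribʳ-* q q 500) (sym (^-distribˡ-+-* q 500 500))))

  k*q²≤2^b : k * (q * q) ≤ 2 ^ b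
  k*q²≤2^b = ≤-trans (^-cancelˡ-≤ 500 (k * (q * q)) (2 ^ (k + 2 * r * a)) (begin
    (k * (q * q)) ^ 500
      ≡⟨ [kq²]^500≡k^500*q^1000 ⟩
    k ^ 500 * q ^ 1000
      ≤⟨ *-mono-≤ (^-monoˡ-≤ 500 (<⇒≤ (n<2^n k))) (≤-trans q¹⁰⁰⁰≤nᵃ (^-monoˡ-≤ a n≤[2^r]^1000)) ⟩
    (2 ^ k) ^ 500 * ((2 ^ r) ^ 1000) ^ a
      ≡⟨ cong₂ _*_ (^-*-assoc 2 k 500) (trans (^-*-assoc (2 ^ r) 1000 a) (^-*-assoc 2 r (1000 * a))) ⟩
    2 ^ (k * 500) * 2 ^ (r * (1000 * a))
      ≡⟨ ^-distribˡ-+-* 2 (k * 500) (r * (1000 * a)) ⟨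
    2 ^ (k * 500 + r * (1000 * a))
      ≡⟨ cong (2 ^_) (solve 3 (λ k r a → k :* con 500 :+ r :* (con 1000 :* a) := (k :+ con 2 :* r :* a) :* con 500) refl k r a) ⟩
    2 ^ ((k + 2 * r * a) * 500)
      ≡⟨ ^-*-assoc 2 (k + 2 * r * a) 500 ⟨
    (2 ^ (k + 2 * r * a)) ^ 500 ∎)) (^-monoʳ-≤ 2 k+2ra≤b)
    where
    n≤[2^r]^1000 : n ≤ (2 ^ r) ^ 1000
    n≤[2^r]^1000 = <⇒≤ (<-≤-trans n<[2r]¹⁰⁰⁰ (^-monoˡ-≤ 1000 (2*n≤2^n r 1≤r)))
    k+2ra≤b : k + 2 * r * a ≤ b
    k+2ra≤b = begin
      k + 2 * r * a               ≤⟨ +-mono-≤ (≤-trans k≤r (m≤m^n r 492 1≤r (s≤s z≤n))) (*-monoʳ-≤ (2 * r) a≤r^491) ⟩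
      r ^ 492 + 2 * r * r ^ 491   ≡⟨ solve 2 (λ r x → r :* x :+ con 2 :* r :* x := con 3 :* (r :* x)) refl r (r ^ 491) ⟩
      3 * r ^ 492                 ≤⟨ *-monoˡ-≤ (r ^ 492) (c≤r 3 (≤-trans (s≤s (s≤s (s≤s z≤n))) 4≤2¹⁰¹⁰)) ⟩
      r ^ 493                     ≤⟨ m^n≤m^[n+o] r 493 3 1≤r ⟩
      b                           ∎

  few-differences : ∀ d e → d ≤ n → k ^ 500 * d ^ 500 ≤ n ^ 499 →
    k * (q * q) * (d C a) * (n ∸ a ∸ e) ^ s ≤ (n C a) * (n ∸ a) ^ s
  few-differences d e d≤n kd≤n = *-cancelʳ-≤ _ _ (n ^ a) {{>-nonZero (1≤m^n n a 1≤n)}} (begin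
    K * (d C a) * (#C ∸ e) ^ s * n ^ a
      ≤⟨ *-monoˡ-≤ (n ^ a) (*-monoʳ-≤ (K * (d C a)) (^-monoˡ-≤ s (m∸n≤m #C e))) ⟩
    K * (d C a) * #C ^ s * n ^ a
      ≡⟨ solve 4 (λ x b c m → x :* b :* c :* m := x :* (b :* m) :* c) refl K (d C a) (#C ^ s) (n ^ a) ⟩
    K * ((d C a) * n ^ a) * #C ^ s
      ≤⟨ *-monoˡ-≤ (#C ^ s) (*-monoʳ-≤ K (dCa*v^a≤nCa*u^a a d n d n (≤-reflexive (*-comm d n)) d≤n)) ⟩
    K * ((n C a) * d ^ a) * #C ^ s
      ≡⟨ solve 4 (λ x b c m → x :* (b :* m) :* c := x :* m :* (b :* c)) refl K (n C a) (#C ^ s) (d ^ a) ⟩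
    K * d ^ a * ((n C a) * #C ^ s)
      ≤⟨ *-monoˡ-≤ ((n C a) * #C ^ s) (^-cancelˡ-≤ 500 (K * d ^ a) (n ^ a) Kdᵃ⁵⁰⁰≤nᵃ⁵⁰⁰) ⟩
    n ^ a * ((n C a) * #C ^ s)
      ≡⟨ *-comm (n ^ a) _ ⟩
    (n C a) * #C ^ s * n ^ a ∎)
    where
    K #C : ℕ
    K = k * (q * q)
    #C = n ∸ a
    1≤n : 1 ≤ n
    1≤n = ≤-trans (1≤m^n r 1000 1≤r) r¹⁰⁰⁰≤n
    ^500^a : ∀ m → (m ^ 500) ^ a ≡ (m ^ a) ^ 500
    ^500^a m = trans (^-*-assoc m 500 a) (trans (cong (m ^_) (*-comm 500 a)) (sym (^-*-assoc m a 500)))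
    Kdᵃ⁵⁰⁰≤nᵃ⁵⁰⁰ : (K * d ^ a) ^ 500 ≤ (n ^ a) ^ 500
    Kdᵃ⁵⁰⁰≤nᵃ⁵⁰⁰ = begin
      (K * d ^ a) ^ 500
        ≡⟨ trans (^-distribʳ-* K (d ^ a) 500) (cong₂ _*_ [kq²]^500≡k^500*q^1000 (sym (^500^a d))) ⟩
      k ^ 500 * q ^ 1000 * (d ^ 500) ^ a
        ≤⟨ *-monoˡ-≤ ((d ^ 500) ^ a) (*-mono-≤ (m≤m^n (k ^ 500) a (1≤m^n k 500 1≤k) 1≤a) q¹⁰⁰⁰≤nᵃ) ⟩
      (k ^ 500) ^ a * n ^ a * (d ^ 500) ^ a
        ≡⟨ solve 3 (λ x y z → x :* y :* z := x :* z :* y) refl ((k ^ 500) ^ a) (n ^ a) ((d ^ 500) ^ a) ⟩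
      (k ^ 500) ^ a * (d ^ 500) ^ a * n ^ a
        ≡⟨ cong (_* n ^ a) (^-distribʳ-* (k ^ 500) (d ^ 500) a) ⟨
      (k ^ 500 * d ^ 500) ^ a * n ^ a
        ≤⟨ *-monoˡ-≤ (n ^ a) (^-monoˡ-≤ a kd≤n) ⟩
      (n ^ 499) ^ a * n ^ a
        ≡⟨ ^-distribʳ-* (n ^ 499) n a ⟨
      (n ^ 499 * n) ^ a
        ≡⟨ cong (_^ a) (trans (cong (n ^ 499 *_) (sym (*-identityʳ n))) (sym (^-distribˡ-+-* n 499 1))) ⟩
      (n ^ 500) ^ a
        ≡⟨ ^500^a n ⟩
      (n ^ a) ^ 500 ∎

  many-differences : ∀ d e → d ≤ n → d ≤ 2 * e + 2 * a → r ^ 998 < k * d →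
    k * (q * q) * (d C a) * (n ∸ a ∸ e) ^ s ≤ (n C a) * (n ∸ a) ^ s
  many-differences d e d≤n d≤2e+2a r⁹⁹⁸<kd = begin
    K * (d C a) * (#C ∸ e) ^ s
      ≤⟨ *-monoˡ-≤ ((#C ∸ e) ^ s) (*-monoʳ-≤ K (C-monoˡ-≤ a d≤n)) ⟩
    K * (n C a) * (#C ∸ e) ^ s
      ≡⟨ solve 3 (λ x y z → x :* y :* z := y :* (x :* z)) refl K (n C a) ((#C ∸ e) ^ s) ⟩
    (n C a) * (K * (#C ∸ e) ^ s)
      ≤⟨ *-monoʳ-≤ (n C a) (*-monoˡ-≤ ((#C ∸ e) ^ s) k*q²≤2^b) ⟩
    (n C a) * (2 ^ b * (#C ∸ e) ^ s)
      ≤⟨ *-monoʳ-≤ (n C a) (decay b j′ s #C e #C≤[1+j′]e b[1+j′]≤s) ⟩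
    (n C a) * #C ^ s ∎
    where
    K #C : ℕ
    K = k * (q * q)
    #C = n ∸ a
    4ka≤r^998 : 4 * k * a ≤ r ^ 998
    4ka≤r^998 = begin
      4 * k * a                     ≤⟨ *-monoʳ-≤ (4 * k) a≤r^491 ⟩
      4 * k * r ^ 491               ≤⟨ *-monoˡ-≤ (r ^ 491) (c*k≤r 4 4≤2¹⁰¹⁰) ⟩
      r ^ 492                       ≤⟨ m^n≤m^[n+o] r 492 506 1≤r ⟩
      r ^ 998                       ∎
    r⁹⁹⁸<4ke : r ^ 998 < 4 * k * e
    r⁹⁹⁸<4ke = +-cancelʳ-< (r ^ 998) (r ^ 998) (4 * k * e) (begin-strict
      r ^ 998 + r ^ 998             ≡⟨ cong (r ^ 998 +_) (+-identityʳ _) ⟨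
      2 * r ^ 998                   <⟨ *-monoʳ-< 2 r⁹⁹⁸<kd ⟩
      2 * (k * d)                   ≤⟨ *-monoʳ-≤ 2 (*-monoʳ-≤ k d≤2e+2a) ⟩
      2 * (k * (2 * e + 2 * a))     ≡⟨ solve 3 (λ k e a → con 2 :* (k :* (con 2 :* e :+ con 2 :* a))
                                                         := con 4 :* k :* e :+ con 4 :* k :* a) refl k e a ⟩
      4 * k * e + 4 * k * a         ≤⟨ +-monoʳ-≤ (4 * k * e) 4ka≤r^998 ⟩
      4 * k * e + r ^ 998           ∎)
    j′ : ℕ
    j′ = 2¹⁰⁰⁰ * r ^ 2 * (4 * k) ∸ 1
    1+j′≡ : suc j′ ≡ 2¹⁰⁰⁰ * r ^ 2 * (4 * k)
    1+j′≡ = trans (+-comm 1 j′) (m∸n+n≡m (*-mono-≤ (*-mono-≤ 1≤2¹⁰⁰⁰ (1≤m^n r 2 1≤r)) (*-mono-≤ {1} {4} (s≤s z≤n) 1≤k)))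
    #C≤[1+j′]e : #C ≤ suc j′ * e
    #C≤[1+j′]e = begin
      #C                                   ≤⟨ m∸n≤m n a ⟩
      n                                    ≤⟨ <⇒≤ n<[2r]¹⁰⁰⁰ ⟩
      (2 * r) ^ 1000                       ≡⟨ trans (^-distribʳ-* 2 r 1000) (cong₂ _*_ 2^1000≡2¹⁰⁰⁰ (^-distribˡ-+-* r 2 998)) ⟩
      2¹⁰⁰⁰ * (r ^ 2 * r ^ 998)         ≤⟨ *-monoʳ-≤ (2¹⁰⁰⁰) (*-monoʳ-≤ (r ^ 2) (<⇒≤ r⁹⁹⁸<4ke)) ⟩
      2¹⁰⁰⁰ * (r ^ 2 * (4 * k * e))     ≡⟨ solve 4 (λ c x k e → c :* (x :* (con 4 :* k :* e)) := c :* x :* (con 4 :* k) :* e) refl (2¹⁰⁰⁰) (r ^ 2) k e ⟩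
      2¹⁰⁰⁰ * r ^ 2 * (4 * k) * e       ≡⟨ cong (_* e) 1+j′≡ ⟨
      suc j′ * e                           ∎
    b[1+j′]≤s : b * suc j′ ≤ s
    b[1+j′]≤s = begin
      b * suc j′                           ≡⟨ cong (b *_) 1+j′≡ ⟩
      r ^ 496 * (2¹⁰⁰⁰ * r ^ 2 * (4 * k)) ≡⟨ solve 4 (λ x c y k → x :* (c :* y :* (con 4 :* k)) := (c :* con 4) :* k :* (x :* y)) refl (r ^ 496) (2¹⁰⁰⁰) (r ^ 2) k ⟩
      2¹⁰⁰⁰ * 4 * k * (r ^ 496 * r ^ 2) ≤⟨ *-monoˡ-≤ (r ^ 496 * r ^ 2) (c*k≤r (2¹⁰⁰⁰ * 4) 2¹⁰⁰⁰*4≤2¹⁰¹⁰) ⟩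
      r * (r ^ 496 * r ^ 2)                ≡⟨ cong (r *_) (^-distribˡ-+-* r 496 2) ⟨
      r ^ 499                              ≤⟨ r^499≤s ⟩
      s                                    ∎

  pair-estimate : ∀ d e → d ≤ n → d ≤ 2 * e + 2 * a →
    k * (q * q) * (d C a) * (n ∸ a ∸ e) ^ s ≤ (n C a) * (n ∸ a) ^ s
  pair-estimate d e d≤n d≤2e+2a with k ^ 500 * d ^ 500 ≤? n ^ 499
  ... | yes kd≤n = few-differences d e d≤n kd≤n
  ... | no kd≰n = many-differences d e d≤n d≤2e+2a (^-cancelˡ-< 500 (r ^ 998) (k * d) (begin-strict
    (r ^ 998) ^ 500         ≡⟨ trans (^-*-assoc r 998 500) (sym (^-*-assoc r 1000 499)) ⟩
    (r ^ 1000) ^ 499        ≤⟨ ^-monoˡ-≤ 499 r¹⁰⁰⁰≤n ⟩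
    n ^ 499                 <⟨ ≰⇒> kd≰n ⟩
    k ^ 500 * d ^ 500       ≡⟨ ^-distribʳ-* k d 500 ⟨
    (k * d) ^ 500           ∎))

lemma4p6 : ∃[ m ] (1 ≤ m × (∀ k → 1 ≤ k → ∃[ N ] (∀ n → N ≤ n →
    ∀ a → m < 2 ^ a → a ^ 100 ≤ n ^ 49 →
    ∀ s → s * s ≤ n ∸ a → n ∸ a < suc s * suc s →
    ∀ q → q ^ 1000 ≤ n ^ a → n ^ a < suc q ^ 1000 →
    ∀ (Q : List (Vec Bool n)) → Unique Q → length Q ≡ q →
    k * badCount n a s (2 ^ s / 10) Q ≤ totalCount n a s (2 ^ s / 10))))
-- Neither the distinctness of Q, nor the upper bound on q, nor the value of L is needed.
lemma4p6 = 1 , ≤-refl , λ k 1≤k → (2¹⁰¹⁰ * k) ^ 1000 ,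
  λ n N≤n a 1<2ᵃ a¹⁰⁰≤n⁴⁹ s s²≤n∸a n∸a<[1+s]² q q¹⁰⁰⁰≤nᵃ _ Q _ |Q|≡q →
  let r , r¹⁰⁰⁰≤n , n<[r+1]¹⁰⁰⁰ = integer-root 1000 n
      2¹⁰¹⁰k≤r : 2¹⁰¹⁰ * k ≤ r
      2¹⁰¹⁰k≤r = s≤s⁻¹ (≤-trans (^-cancelˡ-< 1000 (2¹⁰¹⁰ * k) (r + 1) (≤-<-trans N≤n n<[r+1]¹⁰⁰⁰))
                               (≤-reflexive (+-comm r 1)))
      open Estimates k n r a s q 1≤k 2¹⁰¹⁰k≤r r¹⁰⁰⁰≤n n<[r+1]¹⁰⁰⁰ (1≤a 1<2ᵃ) a¹⁰⁰≤n⁴⁹ s²≤n∸a n∸a<[1+s]² q¹⁰⁰⁰≤nᵃ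
  in k*badCount≤totalCount n a s (2 ^ s / 10) k q Q |Q|≡q 1≤n∸a λ x y →
       pair-estimate (hamming x y) (excess a x y) (countFin-≤ _) (hamming≤2*excess+2*a a x y)
  where
  1≤a : ∀ {a} → 1 < 2 ^ a → 1 ≤ a
  1≤a {zero} (s≤s ())
  1≤a {suc a} _ = s≤s z≤n
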